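{- Let $A$ be a Dirac ring. If a graded $A$-module $M$ is both flat and evenly generated, then it is evenly presented.
   Context: A Dirac ring is a $\mathbb{Z}$-graded ring $A=\bigoplus_d A_d$ with $ab=(-1)^{\deg a\deg b}ba$ for homogeneous $a,b$. $M$ is flat if $M\otimes_A-$ is exact on graded $A$-modules. For a graded set $S=(S_d)$ let $A(S)$ be the free graded $A$-module on $S$; a family of homogeneous elements $x\colon S\to M$ is even if $S_d=\emptyset$ for $d$ odd. $M$ is evenly generated if some even family generates $M$ (i.e. $A(S)\to M$ surjective); $M$ is evenly presented if there is an even generating family $x\colon S\to M$ such that the kernel of $A(S)\to M$ is generated by an even family. -}

module Defs where

open import Level using (Level) renaming (suc to lsuc)
open import Data.Bool using (Bool; true; false; if_then_else_)
open import Data.Nat using (ℕ; _≡ᵇ_; _%_)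
open import Data.Integer using (ℤ; 0ℤ; ∣_∣) renaming (_+_ to _+ℤ_; _*_ to _*ℤ_)
import Data.Integer.Properties as ℤP
open import Data.Product using (Σ; ∃; _×_; _,_)
open import Data.Empty using (⊥)
open import Relation.Binary.PropositionalEquality using (_≡_; subst; trans; cong)
open import Relation.Binary.Core using (Rel)
open import Algebra.Core using (Op₁; Op₂)
open import Algebra.Structures using (IsAbelianGroup)

isOdd : ℤ → Bool
isOdd k = (∣ k ∣ % 2) ≡ᵇ 1

record GradedAbelianGroup (ℓ : Level) : Set (lsuc ℓ) where
  infix 4 _≈_
  infixl 6 _⊕_
  field
    Carrier : ℤ → Set ℓ
    _≈_ : ∀ {d} → Rel (Carrier d) ℓ
    _⊕_ : ∀ {d} → Op₂ (Carrier d)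
    ε : ∀ {d} → Carrier d
    ⊖_ : ∀ {d} → Op₁ (Carrier d)
    isAbelianGroup : ∀ d → IsAbelianGroup (_≈_ {d}) _⊕_ ε ⊖_

  tr : ∀ {d e} → d ≡ e → Carrier d → Carrier e
  tr = subst Carrier

  sign : ∀ {d} → ℤ → Carrier d → Carrier d
  sign k x = if isOdd k then ⊖ x else x

record DiracRing (ℓ : Level) : Set (lsuc ℓ) where
  field
    grp : GradedAbelianGroup ℓ
  open GradedAbelianGroup grp public
  infixl 7 _*_
  field
    _*_ : ∀ {d e} → Carrier d → Carrier e → Carrier (d +ℤ e)
    1# : Carrier 0ℤ
    *-cong : ∀ {d e} {a a' : Carrier d} {b b' : Carrier e} →
             a ≈ a' → b ≈ b' → a * b ≈ a' * b'
    *-distribˡ : ∀ {d e} (a : Carrier d) (b b' : Carrier e) →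
                 a * (b ⊕ b') ≈ a * b ⊕ a * b'
    *-distribʳ : ∀ {d e} (a a' : Carrier d) (b : Carrier e) →
                 (a ⊕ a') * b ≈ a * b ⊕ a' * b
    *-assoc : ∀ {d e f} (a : Carrier d) (b : Carrier e) (c : Carrier f) →
              tr (ℤP.+-assoc d e f) ((a * b) * c) ≈ a * (b * c)
    *-identityˡ : ∀ {d} (a : Carrier d) → tr (ℤP.+-identityˡ d) (1# * a) ≈ a
    *-identityʳ : ∀ {d} (a : Carrier d) → tr (ℤP.+-identityʳ d) (a * 1#) ≈ a
    *-gradedComm : ∀ {d e} (a : Carrier d) (b : Carrier e) →
                   tr (ℤP.+-comm d e) (a * b) ≈ sign (d *ℤ e) (b * a)

-- Formal abelian-group expressions over a set of generators, and the
-- abelian-group congruence generated by a relation (quotients as setoids).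

data FAb {ℓ : Level} (G : Set ℓ) : Set ℓ where
  gen  : G → FAb G
  zero : FAb G
  neg  : FAb G → FAb G
  add  : FAb G → FAb G → FAb G

mapFAb : ∀ {ℓ} {G H : Set ℓ} → (G → H) → FAb G → FAb H
mapFAb f (gen g) = gen (f g)
mapFAb f zero = zero
mapFAb f (neg x) = neg (mapFAb f x)
mapFAb f (add x y) = add (mapFAb f x) (mapFAb f y)

foldFAb : ∀ {ℓ c} {G : Set ℓ} {C : Set c} →
          (G → C) → C → (C → C) → (C → C → C) → FAb G → C
foldFAb g z n a (gen x) = g x
foldFAb g z n a zero = z
foldFAb g z n a (neg x) = n (foldFAb g z n a x)
foldFAb g z n a (add x y) = a (foldFAb g z n a x) (foldFAb g z n a y)

signFAb : ∀ {ℓ} {G : Set ℓ} → ℤ → FAb G → FAb G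
signFAb k x = if isOdd k then neg x else x

data Closure {ℓ : Level} {G : Set ℓ} (B : Rel (FAb G) ℓ) : Rel (FAb G) ℓ where
  base      : ∀ {x y} → B x y → Closure B x y
  c-refl    : ∀ {x} → Closure B x x
  c-sym     : ∀ {x y} → Closure B x y → Closure B y x
  c-trans   : ∀ {x y z} → Closure B x y → Closure B y z → Closure B x z
  add-cong  : ∀ {x x' y y'} → Closure B x x' → Closure B y y' →
              Closure B (add x y) (add x' y')
  neg-cong  : ∀ {x y} → Closure B x y → Closure B (neg x) (neg y)
  add-assoc : ∀ x y z → Closure B (add (add x y) z) (add x (add y z))
  add-comm  : ∀ x y → Closure B (add x y) (add y x)
  add-idˡ   : ∀ x → Closure B (add zero x) x
  add-invˡ  : ∀ x → Closure B (add (neg x) x) zero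

module _ {ℓ : Level} (R : DiracRing ℓ) where
  private
    module R = DiracRing R

  record GradedModule : Set (lsuc ℓ) where
    field
      grp : GradedAbelianGroup ℓ
    open GradedAbelianGroup grp public
    infixr 7 _·_
    field
      _·_ : ∀ {d e} → R.Carrier d → Carrier e → Carrier (d +ℤ e)
      ·-cong : ∀ {d e} {a a' : R.Carrier d} {m m' : Carrier e} →
               a R.≈ a' → m ≈ m' → a · m ≈ a' · m'
      ·-distribˡ : ∀ {d e} (a : R.Carrier d) (m m' : Carrier e) →
                   a · (m ⊕ m') ≈ a · m ⊕ a · m'
      ·-distribʳ : ∀ {d e} (a a' : R.Carrier d) (m : Carrier e) →
                   (a R.⊕ a') · m ≈ a · m ⊕ a' · m
      ·-assoc : ∀ {d e f} (a : R.Carrier d) (b : R.Carrier e) (m : Carrier f) →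
                tr (ℤP.+-assoc d e f) ((a R.* b) · m) ≈ a · (b · m)
      ·-identity : ∀ {d} (m : Carrier d) → tr (ℤP.+-identityˡ d) (R.1# · m) ≈ m

  open GradedModule using (Carrier)

  record Hom (N N' : GradedModule) : Set ℓ where
    private
      module N = GradedModule N
      module N' = GradedModule N'
    field
      ⟦_⟧ : ∀ {d} → N.Carrier d → N'.Carrier d
      ⟦⟧-cong : ∀ {d} {x y : N.Carrier d} → x N.≈ y → ⟦ x ⟧ N'.≈ ⟦ y ⟧
      ⟦⟧-additive : ∀ {d} (x y : N.Carrier d) → ⟦ x N.⊕ y ⟧ N'.≈ ⟦ x ⟧ N'.⊕ ⟦ y ⟧
      ⟦⟧-linear : ∀ {k d} (a : R.Carrier k) (x : N.Carrier d) →
                  ⟦ a N.· x ⟧ N'.≈ a N'.· ⟦ x ⟧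

  -- Free graded module A(S) on a graded set S = (S_d):
  -- in degree n, formal sums of terms a·s (s ∈ S_d, a ∈ A_e, e + d = n),
  -- modulo additivity and congruence in the coefficient.

  data Term (S : ℤ → Set ℓ) (n : ℤ) : Set ℓ where
    term : ∀ {e d} → R.Carrier e → S d → e +ℤ d ≡ n → Term S n

  Free : (S : ℤ → Set ℓ) → ℤ → Set ℓ
  Free S n = FAb (Term S n)

  data FreeBase (S : ℤ → Set ℓ) {n : ℤ} : Rel (Free S n) ℓ where
    coeff-cong : ∀ {e d} {a a' : R.Carrier e} (s : S d) (p : e +ℤ d ≡ n) →
                 a R.≈ a' → FreeBase S (gen (term a s p)) (gen (term a' s p))
    coeff-add : ∀ {e d} (a a' : R.Carrier e) (s : S d) (p : e +ℤ d ≡ n) →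
                FreeBase S (gen (term (a R.⊕ a') s p))
                           (add (gen (term a s p)) (gen (term a' s p)))

  _≈Free_ : ∀ {S : ℤ → Set ℓ} {n} → Rel (Free S n) ℓ
  _≈Free_ {S} = Closure (FreeBase S)

  actFree : ∀ {S : ℤ → Set ℓ} {k n} → R.Carrier k → Free S n → Free S (k +ℤ n)
  actFree {S} {k} b = mapFAb λ { (term {e} {d} a s p) →
    term (b R.* a) s (trans (ℤP.+-assoc k e d) (cong (k +ℤ_) p)) }

  induced : ∀ {S : ℤ → Set ℓ} (C : ℤ → Set ℓ)
            (plus : ∀ {n} → C n → C n → C n) (z : ∀ {n} → C n)
            (minus : ∀ {n} → C n → C n)
            (act : ∀ {k n} → R.Carrier k → C n → C (k +ℤ n))
            (x : ∀ {d} → S d → C d) → ∀ {n} → Free S n → C n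
  induced C plus z minus act x =
    foldFAb (λ { (term a s p) → subst C p (act a (x s)) }) z minus plus

  inducedM : (M : GradedModule) {S : ℤ → Set ℓ} →
             (∀ {d} → S d → Carrier M d) → ∀ {n} → Free S n → Carrier M n
  inducedM M x = induced (Carrier M) M._⊕_ M.ε M.⊖_ M._·_ x
    where module M = GradedModule M

  inducedFree : {S T : ℤ → Set ℓ} →
                (∀ {d} → T d → Free S d) → ∀ {n} → Free T n → Free S n
  inducedFree {S} y = induced (Free S) add zero neg actFree y

  Even : (S : ℤ → Set ℓ) → Set ℓ
  Even S = ∀ d → isOdd d ≡ true → S d → ⊥

  Generates : (M : GradedModule) {S : ℤ → Set ℓ} →
              (∀ {d} → S d → Carrier M d) → Set ℓ
  Generates M {S} x = ∀ n (m : Carrier M n) →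
    ∃ λ (z : Free S n) → GradedModule._≈_ M (inducedM M x z) m

  EvenlyGenerated : GradedModule → Set (lsuc ℓ)
  EvenlyGenerated M =
    Σ (ℤ → Set ℓ) λ S → Σ (∀ {d} → S d → Carrier M d) λ x →
      Even S × Generates M x

  KernelEvenlyGenerated : (M : GradedModule) {S : ℤ → Set ℓ} →
                          (∀ {d} → S d → Carrier M d) → Set (lsuc ℓ)
  KernelEvenlyGenerated M {S} x =
    Σ (ℤ → Set ℓ) λ T → Σ (∀ {d} → T d → Free S d) λ y →
      Even T
      × (∀ d (t : T d) → inducedM M x (y t) M.≈ M.ε)
      × (∀ n (z : Free S n) → inducedM M x z M.≈ M.ε →
           ∃ λ (w : Free T n) → inducedFree y w ≈Free z)
    where module M = GradedModule M

  EvenlyPresented : GradedModule → Set (lsuc ℓ)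
  EvenlyPresented M =
    Σ (ℤ → Set ℓ) λ S → Σ (∀ {d} → S d → Carrier M d) λ x →
      Even S × Generates M x × KernelEvenlyGenerated M x

  -- Tensor product M ⊗_A N, degree n: formal sums of pure tensors
  -- m ⊗ x (m ∈ M_d, x ∈ N_e, d + e = n) modulo biadditivity and
  -- (a·m) ⊗ x = (-1)^(deg a · deg m) m ⊗ (a·x)
  -- (i.e. m·a ⊗ x = m ⊗ a·x for the right action m·a = (-1)^(|a||m|) a·m).

  data Pure (M N : GradedModule) (n : ℤ) : Set ℓ where
    pure : ∀ {d e} → d +ℤ e ≡ n → Carrier M d → Carrier N e → Pure M N n

  data TensorBase (M N : GradedModule) {n : ℤ} : Rel (FAb (Pure M N n)) ℓ where
    ⊗-congˡ : ∀ {d e} (p : d +ℤ e ≡ n) {m m' : Carrier M d} (x : Carrier N e) →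
              GradedModule._≈_ M m m' →
              TensorBase M N (gen (pure p m x)) (gen (pure p m' x))
    ⊗-congʳ : ∀ {d e} (p : d +ℤ e ≡ n) (m : Carrier M d) {x x' : Carrier N e} →
              GradedModule._≈_ N x x' →
              TensorBase M N (gen (pure p m x)) (gen (pure p m x'))
    ⊗-addˡ : ∀ {d e} (p : d +ℤ e ≡ n) (m m' : Carrier M d) (x : Carrier N e) →
             TensorBase M N (gen (pure p (GradedModule._⊕_ M m m') x))
                            (add (gen (pure p m x)) (gen (pure p m' x)))
    ⊗-addʳ : ∀ {d e} (p : d +ℤ e ≡ n) (m : Carrier M d) (x x' : Carrier N e) →
             TensorBase M N (gen (pure p m (GradedModule._⊕_ N x x')))
                            (add (gen (pure p m x)) (gen (pure p m x')))
    ⊗-balance : ∀ {k d e} (a : R.Carrier k) (m : Carrier M d) (x : Carrier N e)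
                (p : (k +ℤ d) +ℤ e ≡ n) (q : d +ℤ (k +ℤ e) ≡ n) →
                TensorBase M N (gen (pure p (GradedModule._·_ M a m) x))
                               (signFAb (k *ℤ d)
                                 (gen (pure q m (GradedModule._·_ N a x))))

  Tensor : (M N : GradedModule) → ℤ → Set ℓ
  Tensor M N n = FAb (Pure M N n)

  _≈⊗_ : ∀ {M N : GradedModule} {n} → Rel (Tensor M N n) ℓ
  _≈⊗_ {M} {N} = Closure (TensorBase M N)

  tensorMap : (M : GradedModule) {N N' : GradedModule} → Hom N N' →
              ∀ {n} → Tensor M N n → Tensor M N' n
  tensorMap M f = mapFAb λ { (pure p m x) → pure p m (Hom.⟦_⟧ f x) }

  IsExact : {X Y Z : ℤ → Set ℓ}
            (_≈Y_ : ∀ {n} → Rel (Y n) ℓ) (_≈Z_ : ∀ {n} → Rel (Z n) ℓ)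
            (0Z : ∀ {n} → Z n)
            (f : ∀ {n} → X n → Y n) (g : ∀ {n} → Y n → Z n) → Set ℓ
  IsExact {X} {Y} _≈Y_ _≈Z_ 0Z f g =
    (∀ n (x : X n) → g (f x) ≈Z 0Z)
    × (∀ n (y : Y n) → g y ≈Z 0Z → ∃ λ (x : X n) → f x ≈Y y)

  Flat : GradedModule → Set (lsuc ℓ)
  Flat M =
    (N' N N'' : GradedModule) (f : Hom N' N) (g : Hom N N'') →
    IsExact {Carrier N'} (GradedModule._≈_ N) (GradedModule._≈_ N'') (GradedModule.ε N'')
            (Hom.⟦_⟧ f) (Hom.⟦_⟧ g) →
    IsExact {Tensor M N'} (_≈⊗_ {M} {N}) (_≈⊗_ {M} {N''}) zero
            (tensorMap M f) (tensorMap M g)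

-- Let x : S → M be an even generating family and z = Σᵢ aᵢ sᵢ ∈ A(S) a relation of degree n.
-- If n is even, z is itself an even relation. If n is odd, every aᵢ is odd because every sᵢ
-- is even. Let U be free on uᵢ of degree -|sᵢ|, V free on v of degree -n, and g uᵢ = aᵢ v.
-- Then Φ = Σᵢ x(sᵢ) ⊗ uᵢ is killed by M ⊗ g, so by flatness it is the image of some
-- Σⱼ mⱼ ⊗ κⱼ with κⱼ = Σᵢ cᵢⱼ uᵢ ∈ ker g, i.e. Σᵢ cᵢⱼ aᵢ = 0. Comparing uᵢ-coordinates gives
-- x(sᵢ) = Σⱼ ± cᵢⱼ mⱼ; lifting each mⱼ to lⱼ ∈ A(S) yields relations rᵢ = sᵢ - Σⱼ ± cᵢⱼ lⱼ of
-- even degree |sᵢ|, and Σᵢ aᵢ rᵢ = z: commuting the odd aᵢ past cᵢⱼ costs exactly the sign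
-- ± = (-1)^{|cᵢⱼ| |mⱼ|}, as |cᵢⱼ| ≡ |mⱼ| mod 2, so Σᵢ ± aᵢ cᵢⱼ = Σᵢ cᵢⱼ aᵢ = 0.

module Submission where

open import Level using (Level; Lift; lift)
open import Data.Bool using (Bool; true; false; not; _xor_; _∧_; if_then_else_)
open import Data.Bool.Properties
  using (∧-idem; ∧-zeroʳ; xor-same; xor-identityʳ; true-xor; not-distribˡ-xor; not-involutive)
open import Data.Nat as ℕ using (ℕ; zero; suc)
open import Data.Integer as ℤ using (ℤ; +_; -[1+_]; 0ℤ; 1ℤ; ∣_∣; pred; -_)
  renaming (suc to sucℤ; _+_ to _+ℤ_; _*_ to _*ℤ_)
import Data.Integer.Properties as ℤP
open import Data.Integer.Solver using (module +-*-Solver)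
open +-*-Solver using (solve; _:+_; :-_; _:=_)
open import Data.Fin as Fin using (Fin; punchIn; splitAt) renaming (zero to fzero; suc to fsuc)
open import Data.Fin.Properties using (punchInᵢ≢i)
open import Data.Vec.Functional as Vector using (Vector; _++_)
open import Relation.Nullary using (yes; no)
open import Data.Sum.Properties using ([,]-map; [,]-∘)
open import Function using (_∘_)
open import Data.Empty using (⊥-elim)
open import Data.Product using (Σ; ∃; _×_; _,_; proj₁; proj₂)
open import Relation.Binary.Core using (Rel)
import Relation.Binary.Reasoning.Setoid
open import Relation.Binary.PropositionalEquality
  using (_≡_; _≢_; refl; sym; trans; cong; cong₂; subst; module ≡-Reasoning)
open import Algebra.Bundles using (AbelianGroup; CommutativeMonoid)
open import Defs

-- Parity

isOdd-+suc : ∀ n → isOdd (+ suc n) ≡ not (isOdd (+ n))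
isOdd-+suc zero = refl
isOdd-+suc (suc zero) = refl
isOdd-+suc (suc (suc n)) = isOdd-+suc n

isOdd-suc : ∀ i → isOdd (sucℤ i) ≡ not (isOdd i)
isOdd-suc (+ n) = isOdd-+suc n
isOdd-suc -[1+ zero ] = refl
isOdd-suc -[1+ suc n ] = isOdd-+suc n

isOdd-pred : ∀ i → isOdd (pred i) ≡ not (isOdd i)
isOdd-pred i = begin
  isOdd (pred i)                ≡⟨ sym (not-involutive (isOdd (pred i))) ⟩
  not (not (isOdd (pred i)))    ≡⟨ cong not (sym (isOdd-suc (pred i))) ⟩
  not (isOdd (sucℤ (pred i)))   ≡⟨ cong (λ j → not (isOdd j)) (ℤP.suc-pred i) ⟩
  not (isOdd i)                 ∎
  where open ≡-Reasoning

isOdd-+ : ∀ i j → isOdd (i +ℤ j) ≡ isOdd i xor isOdd j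
isOdd-+ (+ zero) j = cong isOdd (ℤP.+-identityˡ j)
isOdd-+ (+ suc m) j = begin
  isOdd (+ suc m +ℤ j)            ≡⟨ cong isOdd (ℤP.+-assoc 1ℤ (+ m) j) ⟩
  isOdd (sucℤ (+ m +ℤ j))         ≡⟨ isOdd-suc (+ m +ℤ j) ⟩
  not (isOdd (+ m +ℤ j))          ≡⟨ cong not (isOdd-+ (+ m) j) ⟩
  not (isOdd (+ m) xor isOdd j)   ≡⟨ not-distribˡ-xor (isOdd (+ m)) _ ⟩
  not (isOdd (+ m)) xor isOdd j   ≡⟨ cong (_xor isOdd j) (sym (isOdd-+suc m)) ⟩
  isOdd (+ suc m) xor isOdd j     ∎
  where open ≡-Reasoning
isOdd-+ -[1+ zero ] j = trans (isOdd-pred j) (sym (true-xor (isOdd j)))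
isOdd-+ -[1+ suc m ] j = begin
  isOdd (pred -[1+ m ] +ℤ j)          ≡⟨ cong isOdd (ℤP.pred-+ -[1+ m ] j) ⟩
  isOdd (pred (-[1+ m ] +ℤ j))        ≡⟨ isOdd-pred (-[1+ m ] +ℤ j) ⟩
  not (isOdd (-[1+ m ] +ℤ j))         ≡⟨ cong not (isOdd-+ -[1+ m ] j) ⟩
  not (isOdd -[1+ m ] xor isOdd j)    ≡⟨ not-distribˡ-xor (isOdd -[1+ m ]) _ ⟩
  not (isOdd -[1+ m ]) xor isOdd j    ≡⟨ cong (_xor isOdd j) (sym (isOdd-pred -[1+ m ])) ⟩
  isOdd (pred -[1+ m ]) xor isOdd j   ∎
  where open ≡-Reasoning

isOdd-*ℕ : ∀ m n → isOdd (+ (m ℕ.* n)) ≡ isOdd (+ m) ∧ isOdd (+ n)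
isOdd-*ℕ zero n = refl
isOdd-*ℕ (suc m) n = begin
  isOdd (+ (n ℕ.+ m ℕ.* n))                  ≡⟨ isOdd-+ (+ n) (+ (m ℕ.* n)) ⟩
  isOdd (+ n) xor isOdd (+ (m ℕ.* n))        ≡⟨ cong (isOdd (+ n) xor_) (isOdd-*ℕ m n) ⟩
  isOdd (+ n) xor (isOdd (+ m) ∧ isOdd (+ n)) ≡⟨ absorb (isOdd (+ m)) (isOdd (+ n)) ⟩
  not (isOdd (+ m)) ∧ isOdd (+ n)            ≡⟨ cong (_∧ isOdd (+ n)) (sym (isOdd-+suc m)) ⟩
  isOdd (+ suc m) ∧ isOdd (+ n)              ∎
  where
  open ≡-Reasoning
  absorb : ∀ a b → b xor (a ∧ b) ≡ not a ∧ b
  absorb true true = refl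
  absorb true false = refl
  absorb false b = xor-identityʳ b

isOdd-* : ∀ i j → isOdd (i *ℤ j) ≡ isOdd i ∧ isOdd j
isOdd-* i j = trans (cong (λ m → isOdd (+ m)) (ℤP.abs-* i j)) (isOdd-*ℕ ∣ i ∣ ∣ j ∣)

isOdd-*even : ∀ i j → isOdd j ≡ false → isOdd (i *ℤ j) ≡ false
isOdd-*even i j j-even = trans (isOdd-* i j) (trans (cong (isOdd i ∧_) j-even) (∧-zeroʳ (isOdd i)))

isOdd-+even : ∀ i j → isOdd j ≡ false → isOdd (i +ℤ j) ≡ isOdd i
isOdd-+even i j j-even = trans (isOdd-+ i j) (trans (cong (isOdd i xor_) j-even) (xor-identityʳ (isOdd i)))

isOdd-+≡0 : ∀ i j → i +ℤ j ≡ 0ℤ → isOdd i ≡ isOdd j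
isOdd-+≡0 i j i+j≡0 = xor≡false⇒≡ (trans (sym (isOdd-+ i j)) (cong isOdd i+j≡0))
  where
  xor≡false⇒≡ : ∀ {a b} → a xor b ≡ false → a ≡ b
  xor≡false⇒≡ {true} {true} _ = refl
  xor≡false⇒≡ {false} {false} _ = refl

balance-parity : ∀ k s t d → isOdd ((t +ℤ d) *ℤ (k +ℤ s)) xor isOdd ((t +ℤ d) *ℤ k)
                             ≡ isOdd (k *ℤ s) xor isOdd (((k +ℤ t) +ℤ d) *ℤ s)
balance-parity k s t d = begin
  isOdd ((t +ℤ d) *ℤ (k +ℤ s)) xor isOdd ((t +ℤ d) *ℤ k)
    ≡⟨ cong₂ _xor_ (trans (isOdd-* (t +ℤ d) (k +ℤ s)) (cong (isOdd (t +ℤ d) ∧_) (isOdd-+ k s)))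
                   (isOdd-* (t +ℤ d) k) ⟩
  (isOdd (t +ℤ d) ∧ (isOdd k xor isOdd s)) xor (isOdd (t +ℤ d) ∧ isOdd k)
    ≡⟨ boolean (isOdd (t +ℤ d)) (isOdd k) (isOdd s) ⟩
  (isOdd k ∧ isOdd s) xor ((isOdd k xor isOdd (t +ℤ d)) ∧ isOdd s)
    ≡⟨ cong₂ _xor_ (sym (isOdd-* k s)) (sym (trans (isOdd-* ((k +ℤ t) +ℤ d) s)
         (cong (_∧ isOdd s) (trans (cong isOdd (ℤP.+-assoc k t d)) (isOdd-+ k (t +ℤ d)))))) ⟩
  isOdd (k *ℤ s) xor isOdd (((k +ℤ t) +ℤ d) *ℤ s) ∎
  where
  open ≡-Reasoning
  boolean : ∀ p k s → (p ∧ (k xor s)) xor (p ∧ k) ≡ (k ∧ s) xor ((k xor p) ∧ s)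
  boolean true true true = refl
  boolean true true false = refl
  boolean true false true = refl
  boolean true false false = refl
  boolean false true true = refl
  boolean false true false = refl
  boolean false false true = refl
  boolean false false false = refl

+-degree-shift : ∀ s t d {n} → s +ℤ t ≡ n → (t +ℤ d) +ℤ s ≡ n +ℤ d
+-degree-shift s t d s+t≡n =
  trans (solve 3 (λ s t d → (t :+ d) :+ s := (s :+ t) :+ d) refl s t d) (cong (_+ℤ d) s+t≡n)

-- Finite sums and folds in abelian groups

module AbelianGroupProperties {c ℓ} (G : AbelianGroup c ℓ) where
  open AbelianGroup G public
    renaming (refl to ≈-refl; sym to ≈-sym; trans to ≈-trans; reflexive to ≈-reflexive)
  open import Algebra.Properties.AbelianGroup G public
    using (ε⁻¹≈ε; ⁻¹-involutive; inverseʳ-unique; ⁻¹-∙-comm)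
  open import Algebra.Properties.CommutativeMonoid.Sum commutativeMonoid public
    using (sum; sum-cong-≋; sum-cong-≗; sum-remove; sum-replicate-zero; ∑-distrib-+)
  open import Algebra.Properties.CommutativeSemigroup
    (CommutativeMonoid.commutativeSemigroup commutativeMonoid) public
    using (interchange)
  module ≈-Reasoning = Relation.Binary.Reasoning.Setoid setoid
  open ≈-Reasoning

  idempotent⇒ε : ∀ {x} → x ≈ x ∙ x → x ≈ ε
  idempotent⇒ε {x} x≈x∙x = begin
    x                  ≈⟨ identityʳ x ⟨
    x ∙ ε              ≈⟨ ∙-congˡ (inverseʳ x) ⟨
    x ∙ (x ∙ x ⁻¹)     ≈⟨ assoc x x (x ⁻¹) ⟨
    (x ∙ x) ∙ x ⁻¹     ≈⟨ ∙-congʳ x≈x∙x ⟨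
    x ∙ x ⁻¹           ≈⟨ inverseʳ x ⟩
    ε                  ∎

  sum-ε : ∀ {k} {f : Vector Carrier k} → (∀ i → f i ≈ ε) → sum f ≈ ε
  sum-ε {k} f≈ε = ≈-trans (sum-cong-≋ f≈ε) (sum-replicate-zero k)

  sum-⁻¹ : ∀ {k} (f : Vector Carrier k) → sum (λ i → f i ⁻¹) ≈ sum f ⁻¹
  sum-⁻¹ {zero} f = ≈-sym ε⁻¹≈ε
  sum-⁻¹ {suc k} f = ≈-trans (∙-congˡ (sum-⁻¹ (f ∘ fsuc))) (⁻¹-∙-comm (f fzero) _)

  sum-δ : ∀ {k} (i : Fin k) {f : Vector Carrier k} → (∀ j → j ≢ i → f j ≈ ε) → sum f ≈ f i
  sum-δ {suc k} i {f} f≈ε = begin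
    sum f                        ≈⟨ sum-remove f ⟩
    f i ∙ sum (f ∘ punchIn i)    ≈⟨ ∙-congˡ (sum-ε (λ j → f≈ε _ (punchInᵢ≢i i j))) ⟩
    f i ∙ ε                      ≈⟨ identityʳ (f i) ⟩
    f i                          ∎

  sum-++ : ∀ {k l} (f : Vector Carrier k) (g : Vector Carrier l) → sum (f ++ g) ≈ sum f ∙ sum g
  sum-++ {zero} f g = ≈-sym (identityˡ (sum g))
  sum-++ {suc k} f g = begin
    f fzero ∙ sum ((f ++ g) ∘ fsuc)
      ≡⟨ cong (f fzero ∙_) (sum-cong-≗ (λ i → [,]-map (splitAt k i))) ⟩
    f fzero ∙ sum ((f ∘ fsuc) ++ g)
      ≈⟨ ∙-congˡ (sum-++ (f ∘ fsuc) g) ⟩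
    f fzero ∙ (sum (f ∘ fsuc) ∙ sum g)
      ≈⟨ assoc _ _ _ ⟨
    sum f ∙ sum g
      ∎

  fold : ∀ {p} {P : Set p} → (P → Carrier) → FAb P → Carrier
  fold h = foldFAb h ε _⁻¹ _∙_

  fold-ε : ∀ {p} {P : Set p} {h : P → Carrier} → (∀ π → h π ≈ ε) → ∀ X → fold h X ≈ ε
  fold-ε h≈ε (gen π) = h≈ε π
  fold-ε h≈ε zero = ≈-refl
  fold-ε h≈ε (neg X) = ≈-trans (⁻¹-cong (fold-ε h≈ε X)) ε⁻¹≈ε
  fold-ε h≈ε (add X Y) = ≈-trans (∙-cong (fold-ε h≈ε X) (fold-ε h≈ε Y)) (identityˡ ε)

  fold-sum : ∀ {p} {P : Set p} (h : P → Carrier) {k} (f : Vector (FAb P) k) →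
             fold h (Vector.foldr add zero f) ≡ sum (fold h ∘ f)
  fold-sum h {zero} f = refl
  fold-sum h {suc k} f = cong (fold h (f fzero) ∙_) (fold-sum h (f ∘ fsuc))

  fold-cong : ∀ {p} {P : Set p} {h h' : P → Carrier} → (∀ π → h π ≈ h' π) →
              ∀ X → fold h X ≈ fold h' X
  fold-cong h≈h' (gen π) = h≈h' π
  fold-cong h≈h' zero = ≈-refl
  fold-cong h≈h' (neg X) = ⁻¹-cong (fold-cong h≈h' X)
  fold-cong h≈h' (add X Y) = ∙-cong (fold-cong h≈h' X) (fold-cong h≈h' Y)

  fold-mapFAb : ∀ {p} {P Q : Set p} (h : Q → Carrier) (f : P → Q) (X : FAb P) →
                fold h (mapFAb f X) ≡ fold (h ∘ f) X
  fold-mapFAb h f (gen π) = refl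
  fold-mapFAb h f zero = refl
  fold-mapFAb h f (neg X) = cong _⁻¹ (fold-mapFAb h f X)
  fold-mapFAb h f (add X Y) = cong₂ _∙_ (fold-mapFAb h f X) (fold-mapFAb h f Y)

  sum-fold : ∀ {p} {P : Set p} {k} (h : Fin k → P → Carrier) (X : FAb P) →
             sum (λ i → fold (h i) X) ≈ fold (λ π → sum (λ i → h i π)) X
  sum-fold h (gen π) = ≈-refl
  sum-fold {k = k} h zero = sum-ε {k} (λ i → ≈-refl)
  sum-fold {k = k} h (neg X) = ≈-trans (sum-⁻¹ {k} _) (⁻¹-cong (sum-fold h X))
  sum-fold {k = k} h (add X Y) = ≈-trans (∑-distrib-+ {k} _ _) (∙-cong (sum-fold h X) (sum-fold h Y))

closureAbelianGroup : ∀ {a} {P : Set a} (B : Rel (FAb P) a) → AbelianGroup a a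
closureAbelianGroup B = record
  { Carrier = FAb _ ; _≈_ = Closure B ; _∙_ = add ; ε = zero ; _⁻¹ = neg
  ; isAbelianGroup = record
    { isGroup = record
      { isMonoid = record
        { isSemigroup = record
          { isMagma = record
            { isEquivalence = record { refl = c-refl ; sym = c-sym ; trans = c-trans }
            ; ∙-cong = add-cong }
          ; assoc = add-assoc }
        ; identity = add-idˡ , (λ x → c-trans (add-comm x zero) (add-idˡ x)) }
      ; inverse = add-invˡ , (λ x → c-trans (add-comm x (neg x)) (add-invˡ x))
      ; ⁻¹-cong = neg-cong }
    ; comm = add-comm } }

mapFAb-sum : ∀ {a} {P Q : Set a} (f : P → Q) {k} (X : Vector (FAb P) k) →
             mapFAb f (Vector.foldr add zero X) ≡ Vector.foldr add zero (mapFAb f ∘ X)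
mapFAb-sum f {zero} X = refl
mapFAb-sum f {suc k} X = cong (add (mapFAb f (X fzero))) (mapFAb-sum f (X ∘ fsuc))

signFAb-even : ∀ {a} {P : Set a} k (X : FAb P) → isOdd k ≡ false → signFAb k X ≡ X
signFAb-even k X k-even rewrite k-even = refl

-- Graded abelian groups and modules

module GradedAbelianGroupProperties {ℓ} (G : GradedAbelianGroup ℓ) where
  open GradedAbelianGroup G

  abelianGroup : ℤ → AbelianGroup ℓ ℓ
  abelianGroup d = record { isAbelianGroup = isAbelianGroup d }

  module H {d : ℤ} = AbelianGroupProperties (abelianGroup d)

  infix 4 _≋_
  _≋_ : ∀ {d e} → Carrier d → Carrier e → Set ℓ
  _≋_ {d} {e} x y = Σ (d ≡ e) λ r → tr r x ≈ y

  ≋-refl : ∀ {d} {x : Carrier d} → x ≋ x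
  ≋-refl = refl , H.≈-refl

  ≋-sym : ∀ {d e} {x : Carrier d} {y : Carrier e} → x ≋ y → y ≋ x
  ≋-sym (refl , x≈y) = refl , H.≈-sym x≈y

  ≋-trans : ∀ {d e f} {x : Carrier d} {y : Carrier e} {z : Carrier f} → x ≋ y → y ≋ z → x ≋ z
  ≋-trans (refl , x≈y) (refl , y≈z) = refl , H.≈-trans x≈y y≈z

  ≈⇒≋ : ∀ {d} {x y : Carrier d} → x ≈ y → x ≋ y
  ≈⇒≋ x≈y = refl , x≈y

  ≋⇒≈ : ∀ {d} {x y : Carrier d} → x ≋ y → x ≈ y
  ≋⇒≈ (refl , x≈y) = x≈y

  subst-≋ : ∀ (f : ℤ → ℤ) {d e} (r : d ≡ e) (x : Carrier (f d)) → subst (Carrier ∘ f) r x ≋ x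
  subst-≋ f refl x = ≋-refl

  tr-≋ : ∀ {d e} (r : d ≡ e) (x : Carrier d) → tr r x ≋ x
  tr-≋ = subst-≋ (λ d → d)

  tr-cong : ∀ {d e} (r : d ≡ e) {x y : Carrier d} → x ≈ y → tr r x ≈ tr r y
  tr-cong refl x≈y = x≈y

  tr-⊕ : ∀ {d e} (r : d ≡ e) (x y : Carrier d) → tr r (x ⊕ y) ≡ tr r x ⊕ tr r y
  tr-⊕ refl x y = refl

  tr-⊖ : ∀ {d e} (r : d ≡ e) (x : Carrier d) → tr r (⊖ x) ≡ ⊖ tr r x
  tr-⊖ refl x = refl

  tr-ε : ∀ {d e} (r : d ≡ e) → tr r (ε {d}) ≡ ε
  tr-ε refl = refl

  tr-fold : ∀ {p} {P : Set p} {d e} (r : d ≡ e) (h : P → Carrier d) (X : FAb P) →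
            tr r (H.fold h X) ≡ H.fold (tr r ∘ h) X
  tr-fold refl h X = refl

  tr-sum : ∀ {d e k} (r : d ≡ e) (f : Vector (Carrier d) k) → tr r (H.sum f) ≡ H.sum (tr r ∘ f)
  tr-sum refl f = refl

  module ≋-Reasoning where
    infix  1 begin_
    infixr 2 _≋⟨_⟩_ _≋⟨_⟨_ _≈⟨_⟩_ _≈⟨_⟨_ _≡⟨_⟩_
    infix  3 _∎

    begin_ : ∀ {d e} {x : Carrier d} {y : Carrier e} → x ≋ y → x ≋ y
    begin x≋y = x≋y

    _≋⟨_⟩_ : ∀ {d e f} (x : Carrier d) {y : Carrier e} {z : Carrier f} → x ≋ y → y ≋ z → x ≋ z
    x ≋⟨ x≋y ⟩ y≋z = ≋-trans x≋y y≋z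

    _≋⟨_⟨_ : ∀ {d e f} (x : Carrier d) {y : Carrier e} {z : Carrier f} → y ≋ x → y ≋ z → x ≋ z
    x ≋⟨ y≋x ⟨ y≋z = ≋-trans (≋-sym y≋x) y≋z

    _≈⟨_⟩_ : ∀ {d f} (x : Carrier d) {y : Carrier d} {z : Carrier f} → x ≈ y → y ≋ z → x ≋ z
    x ≈⟨ x≈y ⟩ y≋z = ≋-trans (≈⇒≋ x≈y) y≋z

    _≈⟨_⟨_ : ∀ {d f} (x : Carrier d) {y : Carrier d} {z : Carrier f} → y ≈ x → y ≋ z → x ≋ z
    x ≈⟨ y≈x ⟨ y≋z = ≋-trans (≈⇒≋ (H.≈-sym y≈x)) y≋z

    _≡⟨_⟩_ : ∀ {d f} (x : Carrier d) {y : Carrier d} {z : Carrier f} → x ≡ y → y ≋ z → x ≋ z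
    x ≡⟨ refl ⟩ y≋z = y≋z

    _∎ : ∀ {d} (x : Carrier d) → x ≋ x
    x ∎ = ≋-refl

  ≋ε⇒≈ε : ∀ {d e} {x : Carrier d} → x ≋ ε {e} → x ≈ ε
  ≋ε⇒≈ε (refl , x≈ε) = x≈ε

  ⊕-cong≋ : ∀ {d e} {x x' : Carrier d} {y y' : Carrier e} → x ≋ y → x' ≋ y' → x ⊕ x' ≋ y ⊕ y'
  ⊕-cong≋ (refl , x≈y) (refl , x'≈y') = refl , H.∙-cong x≈y x'≈y'

  ⊖-cong≋ : ∀ {d e} {x : Carrier d} {y : Carrier e} → x ≋ y → ⊖ x ≋ ⊖ y
  ⊖-cong≋ (refl , x≈y) = refl , H.⁻¹-cong x≈y

  negIf : ∀ {d} → Bool → Carrier d → Carrier d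
  negIf b x = if b then ⊖ x else x

  negIf-cong : ∀ {d} b {x y : Carrier d} → x ≈ y → negIf b x ≈ negIf b y
  negIf-cong true x≈y = H.⁻¹-cong x≈y
  negIf-cong false x≈y = x≈y

  negIf-cong≋ : ∀ {d e} b {x : Carrier d} {y : Carrier e} → x ≋ y → negIf b x ≋ negIf b y
  negIf-cong≋ b (refl , x≈y) = refl , negIf-cong b x≈y

  negIf-xor : ∀ {d} b c (x : Carrier d) → negIf (b xor c) x ≈ negIf b (negIf c x)
  negIf-xor true true x = H.≈-sym (H.⁻¹-involutive x)
  negIf-xor true false x = H.≈-refl
  negIf-xor false c x = H.≈-refl

  negIf-ε : ∀ {d} b → negIf b (ε {d}) ≈ ε
  negIf-ε true = H.ε⁻¹≈ε
  negIf-ε false = H.≈-refl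

  negIf-⊕ : ∀ {d} b (x y : Carrier d) → negIf b (x ⊕ y) ≈ negIf b x ⊕ negIf b y
  negIf-⊕ true x y = H.≈-sym (H.⁻¹-∙-comm x y)
  negIf-⊕ false x y = H.≈-refl

module GradedModules {ℓ} (A : DiracRing ℓ) where
  private
    module A = DiracRing A
    module AP = GradedAbelianGroupProperties A.grp

  module ModuleProperties (N : GradedModule A) where
    open GradedModule N
    open GradedAbelianGroupProperties grp public

    ·-zeroʳ : ∀ {k d} (a : A.Carrier k) → a · ε {d} ≈ ε
    ·-zeroʳ a = H.idempotent⇒ε
      (H.≈-trans (·-cong AP.H.≈-refl (H.≈-sym (H.identityˡ ε))) (·-distribˡ a ε ε))

    ·-zeroˡ : ∀ {k d} (m : Carrier d) → A.ε {k} · m ≈ ε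
    ·-zeroˡ m = H.idempotent⇒ε
      (H.≈-trans (·-cong (AP.H.≈-sym (AP.H.identityˡ A.ε)) H.≈-refl) (·-distribʳ A.ε A.ε m))

    ·-negʳ : ∀ {k d} (a : A.Carrier k) (m : Carrier d) → a · (⊖ m) ≈ ⊖ (a · m)
    ·-negʳ a m = H.inverseʳ-unique (a · m) (a · ⊖ m)
      (H.≈-trans (H.≈-sym (·-distribˡ a m (⊖ m)))
        (H.≈-trans (·-cong AP.H.≈-refl (H.inverseʳ m)) (·-zeroʳ a)))

    ·-negˡ : ∀ {k d} (a : A.Carrier k) (m : Carrier d) → (A.⊖ a) · m ≈ ⊖ (a · m)
    ·-negˡ a m = H.inverseʳ-unique (a · m) ((A.⊖ a) · m)
      (H.≈-trans (H.≈-sym (·-distribʳ a (A.⊖ a) m))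
        (H.≈-trans (·-cong (AP.H.inverseʳ a) H.≈-refl) (·-zeroˡ m)))

    ·-negIfʳ : ∀ {k d} b (a : A.Carrier k) (m : Carrier d) → a · negIf b m ≈ negIf b (a · m)
    ·-negIfʳ true a m = ·-negʳ a m
    ·-negIfʳ false a m = H.≈-refl

    ·-negIfˡ : ∀ {k d} b (a : A.Carrier k) (m : Carrier d) → AP.negIf b a · m ≈ negIf b (a · m)
    ·-negIfˡ true a m = ·-negˡ a m
    ·-negIfˡ false a m = H.≈-refl

    ·-sumˡ : ∀ {k d n} (c : Vector (A.Carrier k) n) (m : Carrier d) →
             AP.H.sum c · m ≈ H.sum (λ i → c i · m)
    ·-sumˡ {n = zero} c m = ·-zeroˡ m
    ·-sumˡ {n = suc n} c m = H.≈-trans (·-distribʳ (c fzero) _ m) (H.∙-congˡ (·-sumˡ (c ∘ fsuc) m))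

    ·-cong≋ : ∀ {k k' d d'} {a : A.Carrier k} {a' : A.Carrier k'} {m : Carrier d} {m' : Carrier d'} →
              a AP.≋ a' → m ≋ m' → a · m ≋ a' · m'
    ·-cong≋ (refl , a≈a') (refl , m≈m') = refl , ·-cong a≈a' m≈m'

    ·-tr≋ : ∀ {k d e} (a : A.Carrier k) (r : d ≡ e) (m : Carrier d) → a · tr r m ≋ a · m
    ·-tr≋ a refl m = ≋-refl

    ·-assoc≋ : ∀ {k k' d} (a : A.Carrier k) (b : A.Carrier k') (m : Carrier d) →
               (a A.* b) · m ≋ a · (b · m)
    ·-assoc≋ {k} {k'} {d} a b m = ℤP.+-assoc k k' d , ·-assoc a b m

    ·-identity≋ : ∀ {d} (m : Carrier d) → A.1# · m ≋ m
    ·-identity≋ m = ℤP.+-identityˡ _ , ·-identity m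

  regular : GradedModule A
  regular = record
    { grp = A.grp ; _·_ = A._*_ ; ·-cong = A.*-cong ; ·-distribˡ = A.*-distribˡ
    ; ·-distribʳ = A.*-distribʳ ; ·-assoc = A.*-assoc ; ·-identity = A.*-identityˡ }

  module RP = ModuleProperties regular

  *-comm≋ : ∀ {d e} (a : A.Carrier d) (b : A.Carrier e) → a A.* b RP.≋ RP.negIf (isOdd (d *ℤ e)) (b A.* a)
  *-comm≋ {d} {e} a b = ℤP.+-comm d e , A.*-gradedComm a b

  *-identityʳ≋ : ∀ {d} (a : A.Carrier d) → a A.* A.1# RP.≋ a
  *-identityʳ≋ {d} a = ℤP.+-identityʳ d , A.*-identityʳ a

  -- Homomorphisms N → shift regular d are the A-linear functionals of degree d on N.
  shift : GradedModule A → ℤ → GradedModule A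
  shift N d = record
    { grp = record
      { Carrier = λ t → N.Carrier (t +ℤ d) ; _≈_ = N._≈_ ; _⊕_ = N._⊕_ ; ε = N.ε ; ⊖_ = N.⊖_
      ; isAbelianGroup = λ t → N.isAbelianGroup (t +ℤ d) }
    ; _·_ = _·ₛ_
    ; ·-cong = λ a≈a' m≈m' → NP.tr-cong _ (N.·-cong a≈a' m≈m')
    ; ·-distribˡ = λ a m m' →
        NP.H.≈-trans (NP.tr-cong _ (N.·-distribˡ a m m')) (NP.H.≈-reflexive (NP.tr-⊕ _ _ _))
    ; ·-distribʳ = λ a a' m →
        NP.H.≈-trans (NP.tr-cong _ (N.·-distribʳ a a' m)) (NP.H.≈-reflexive (NP.tr-⊕ _ _ _))
    ; ·-assoc = λ {k} {k'} {t} a b m → NP.≋⇒≈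
        (NP.≋-trans (NP.subst-≋ (_+ℤ d) (ℤP.+-assoc k k' t) _)
        (NP.≋-trans (·ₛ≋ t (a A.* b) m)
        (NP.≋-trans (NP.·-assoc≋ a b m)
        (NP.≋-sym (NP.≋-trans (·ₛ≋ (k' +ℤ t) a _) (NP.·-cong≋ AP.≋-refl (·ₛ≋ t b m)))))))
    ; ·-identity = λ {t} m → NP.≋⇒≈
        (NP.≋-trans (NP.subst-≋ (_+ℤ d) (ℤP.+-identityˡ t) _)
        (NP.≋-trans (·ₛ≋ t A.1# m) (NP.·-identity≋ m))) }
    where
    module N = GradedModule N
    module NP = ModuleProperties N
    _·ₛ_ : ∀ {k t} → A.Carrier k → N.Carrier (t +ℤ d) → N.Carrier ((k +ℤ t) +ℤ d)
    _·ₛ_ {k} {t} a m = N.tr (sym (ℤP.+-assoc k t d)) (a N.· m)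
    ·ₛ≋ : ∀ {k} t (a : A.Carrier k) (m : N.Carrier (t +ℤ d)) → _·ₛ_ {t = t} a m NP.≋ a N.· m
    ·ₛ≋ t a m = NP.tr-≋ _ (a N.· m)

  -- Free modules, kernels and tensor products

  module FreeModule (S : ℤ → Set ℓ) where
    infix 4 _≈F_
    _≈F_ : ∀ {n} → Rel (Free A S n) ℓ
    _≈F_ = _≈Free_ A

    freeGroup : GradedAbelianGroup ℓ
    freeGroup = record
      { Carrier = Free A S ; _≈_ = _≈F_ ; _⊕_ = add ; ε = zero ; ⊖_ = neg
      ; isAbelianGroup = λ n → AbelianGroup.isAbelianGroup (closureAbelianGroup (FreeBase A S {n})) }

    open GradedAbelianGroupProperties freeGroup public

    ≡⇒≈F : ∀ {n} {w w' : Free A S n} → w ≡ w' → w ≈F w'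
    ≡⇒≈F refl = c-refl

    gen-≋ : ∀ {n n' e e' d} {a : A.Carrier e} {a' : A.Carrier e'} (s : S d)
            (p : e +ℤ d ≡ n) (p' : e' +ℤ d ≡ n') → a AP.≋ a' → gen (term a s p) ≋ gen (term a' s p')
    gen-≋ s refl refl (refl , a≈a') = refl , base (coeff-cong s refl a≈a')

    term-ε : ∀ {n e d} (s : S d) (p : e +ℤ d ≡ n) → gen (term (A.ε {e}) s p) ≈F zero
    term-ε s p = H.idempotent⇒ε
      (c-trans (base (coeff-cong s p (AP.H.≈-sym (AP.H.identityˡ A.ε)))) (base (coeff-add A.ε A.ε s p)))

    term-⊖ : ∀ {n e d} (a : A.Carrier e) (s : S d) (p : e +ℤ d ≡ n) →
             gen (term (A.⊖ a) s p) ≈F neg (gen (term a s p))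
    term-⊖ a s p = H.inverseʳ-unique _ _
      (c-trans (c-sym (base (coeff-add a (A.⊖ a) s p)))
      (c-trans (base (coeff-cong s p (AP.H.inverseʳ a))) (term-ε s p)))

    act-congʳ : ∀ {k n} (b : A.Carrier k) {w w' : Free A S n} → w ≈F w' → actFree A b w ≈F actFree A b w'
    act-congʳ b (base (coeff-cong s p a≈a')) = base (coeff-cong s _ (A.*-cong AP.H.≈-refl a≈a'))
    act-congʳ b (base (coeff-add a a' s p)) =
      c-trans (base (coeff-cong s _ (A.*-distribˡ b a a'))) (base (coeff-add _ _ s _))
    act-congʳ b c-refl = c-refl
    act-congʳ b (c-sym w≈w') = c-sym (act-congʳ b w≈w')
    act-congʳ b (c-trans w≈w' w'≈w'') = c-trans (act-congʳ b w≈w') (act-congʳ b w'≈w'')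
    act-congʳ b (add-cong w≈w' v≈v') = add-cong (act-congʳ b w≈w') (act-congʳ b v≈v')
    act-congʳ b (neg-cong w≈w') = neg-cong (act-congʳ b w≈w')
    act-congʳ b (add-assoc u v w) = add-assoc _ _ _
    act-congʳ b (add-comm v w) = add-comm _ _
    act-congʳ b (add-idˡ w) = add-idˡ _
    act-congʳ b (add-invˡ w) = add-invˡ _

    act-congˡ : ∀ {k n} {b b' : A.Carrier k} → b A.≈ b' →
                (w : Free A S n) → actFree A b w ≈F actFree A b' w
    act-congˡ b≈b' (gen (term a s p)) = base (coeff-cong s _ (A.*-cong b≈b' AP.H.≈-refl))
    act-congˡ b≈b' zero = c-refl
    act-congˡ b≈b' (neg w) = neg-cong (act-congˡ b≈b' w)
    act-congˡ b≈b' (add v w) = add-cong (act-congˡ b≈b' v) (act-congˡ b≈b' w)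

    act-distribʳ : ∀ {k n} (b b' : A.Carrier k) (w : Free A S n) →
                   actFree A (b A.⊕ b') w ≈F add (actFree A b w) (actFree A b' w)
    act-distribʳ b b' (gen (term a s p)) =
      c-trans (base (coeff-cong s _ (A.*-distribʳ b b' a))) (base (coeff-add _ _ s _))
    act-distribʳ b b' zero = c-sym (add-idˡ zero)
    act-distribʳ b b' (neg w) = c-trans (neg-cong (act-distribʳ b b' w)) (H.≈-sym (H.⁻¹-∙-comm _ _))
    act-distribʳ b b' (add v w) =
      c-trans (add-cong (act-distribʳ b b' v) (act-distribʳ b b' w)) (H.interchange _ _ _ _)

    act-assoc≋ : ∀ {k k' n} (b : A.Carrier k) (b' : A.Carrier k') (w : Free A S n) →
                 actFree A (b A.* b') w ≋ actFree A b (actFree A b' w)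
    act-assoc≋ {k} {k'} b b' (gen (term {e} a s p)) = gen-≋ s _ _ (ℤP.+-assoc k k' e , A.*-assoc b b' a)
    act-assoc≋ {k} {k'} {n} b b' zero = ℤP.+-assoc k k' n , H.≈-reflexive (tr-ε _)
    act-assoc≋ b b' (neg w) = ⊖-cong≋ (act-assoc≋ b b' w)
    act-assoc≋ b b' (add v w) = ⊕-cong≋ (act-assoc≋ b b' v) (act-assoc≋ b b' w)

    act-identity≋ : ∀ {n} (w : Free A S n) → actFree A A.1# w ≋ w
    act-identity≋ (gen (term {e} a s p)) = gen-≋ s _ _ (ℤP.+-identityˡ e , A.*-identityˡ a)
    act-identity≋ {n} zero = ℤP.+-identityˡ n , H.≈-reflexive (tr-ε _)
    act-identity≋ (neg w) = ⊖-cong≋ (act-identity≋ w)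
    act-identity≋ (add v w) = ⊕-cong≋ (act-identity≋ v) (act-identity≋ w)

    freeModule : GradedModule A
    freeModule = record
      { grp = freeGroup ; _·_ = actFree A
      ; ·-cong = λ {_} {_} {b} {b'} {w} b≈b' w≈w' → c-trans (act-congˡ b≈b' w) (act-congʳ b' w≈w')
      ; ·-distribˡ = λ b v w → c-refl
      ; ·-distribʳ = act-distribʳ
      ; ·-assoc = λ b b' w → ≋⇒≈ (≋-trans (tr-≋ _ _) (act-assoc≋ b b' w))
      ; ·-identity = λ w → ≋⇒≈ (≋-trans (tr-≋ _ _) (act-identity≋ w)) }

    open ModuleProperties freeModule public
      using (·-zeroˡ; ·-negIfʳ; ·-negIfˡ; ·-sumˡ; ·-cong≋; ·-tr≋; ·-assoc≋)

    negateTerm : ∀ {n} → Term A S n → Term A S n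
    negateTerm (term a s p) = term (A.⊖ a) s p

    gen-negateTerm : ∀ {n} (t : Term A S n) → gen (negateTerm t) ≈F neg (gen t)
    gen-negateTerm (term a s p) = term-⊖ a s p

    act-fold : ∀ {p} {P : Set p} {k n} (b : A.Carrier k) (h : P → Free A S n) (X : FAb P) →
               actFree A b (H.fold h X) ≡ H.fold (actFree A b ∘ h) X
    act-fold b h (gen π) = refl
    act-fold b h zero = refl
    act-fold b h (neg X) = cong neg (act-fold b h X)
    act-fold b h (add X Y) = cong₂ add (act-fold b h X) (act-fold b h Y)

    termCoeffDegree termGenDegree : ∀ {n} → Term A S n → ℤ
    termCoeffDegree (term {e} a s p) = e
    termGenDegree (term {e} {d} a s p) = d

    termCoeff : ∀ {n} (t : Term A S n) → A.Carrier (termCoeffDegree t)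
    termCoeff (term a s p) = a

    termGen : ∀ {n} (t : Term A S n) → S (termGenDegree t)
    termGen (term a s p) = s

    termDegree : ∀ {n} (t : Term A S n) → termCoeffDegree t +ℤ termGenDegree t ≡ n
    termDegree (term a s p) = p

    term-η : ∀ {n} (t : Term A S n) → term (termCoeff t) (termGen t) (termDegree t) ≡ t
    term-η (term a s p) = refl

    asSumOfTerms : ∀ {n} (w : Free A S n) →
                   Σ ℕ λ k → Σ (Vector (Term A S n) k) λ ts → w ≈F H.sum (gen ∘ ts)
    asSumOfTerms (gen t) = 1 , (λ _ → t) , c-sym (H.identityʳ _)
    asSumOfTerms zero = 0 , (λ ()) , c-refl
    asSumOfTerms (neg w) with asSumOfTerms w
    ... | k , ts , w≈∑ts = k , negateTerm ∘ ts ,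
      c-trans (neg-cong w≈∑ts)
      (c-trans (c-sym (H.sum-⁻¹ (gen ∘ ts))) (H.sum-cong-≋ (λ i → c-sym (gen-negateTerm (ts i)))))
    asSumOfTerms (add v w) with asSumOfTerms v | asSumOfTerms w
    ... | k , ts , v≈∑ts | l , us , w≈∑us = k ℕ.+ l , ts ++ us ,
      c-trans (add-cong v≈∑ts w≈∑us)
      (c-trans (c-sym (H.sum-++ (gen ∘ ts) (gen ∘ us)))
      (≡⇒≈F (sym (H.sum-cong-≗ (λ i → [,]-∘ gen (splitAt k i))))))

  module Induced (N : GradedModule A) {S : ℤ → Set ℓ} (x : ∀ {d} → S d → GradedModule.Carrier N d) where
    open GradedModule N
    open ModuleProperties N
    private module FS = FreeModule S

    ind : ∀ {n} → Free A S n → Carrier n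
    ind = inducedM A N x

    ind-cong : ∀ {n} {w w' : Free A S n} → w FS.≈F w' → ind w ≈ ind w'
    ind-cong (base (coeff-cong s p a≈a')) = tr-cong p (·-cong a≈a' H.≈-refl)
    ind-cong (base (coeff-add a a' s p)) =
      H.≈-trans (tr-cong p (·-distribʳ a a' (x s))) (H.≈-reflexive (tr-⊕ p _ _))
    ind-cong c-refl = H.≈-refl
    ind-cong (c-sym w≈w') = H.≈-sym (ind-cong w≈w')
    ind-cong (c-trans w≈w' w'≈w'') = H.≈-trans (ind-cong w≈w') (ind-cong w'≈w'')
    ind-cong (add-cong w≈w' v≈v') = H.∙-cong (ind-cong w≈w') (ind-cong v≈v')
    ind-cong (neg-cong w≈w') = H.⁻¹-cong (ind-cong w≈w')
    ind-cong (add-assoc u v w) = H.assoc _ _ _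
    ind-cong (add-comm v w) = H.comm _ _
    ind-cong (add-idˡ w) = H.identityˡ _
    ind-cong (add-invˡ w) = H.inverseˡ _

    ind-act : ∀ {k n} (b : A.Carrier k) (w : Free A S n) → ind (actFree A b w) ≈ b · ind w
    ind-act b (gen (term a s p)) =
      ≋⇒≈ (≋-trans (tr-≋ _ _) (≋-trans (·-assoc≋ b a (x s)) (≋-sym (·-tr≋ b p _))))
    ind-act b zero = H.≈-sym (·-zeroʳ b)
    ind-act b (neg w) = H.≈-trans (H.⁻¹-cong (ind-act b w)) (H.≈-sym (·-negʳ b _))
    ind-act b (add v w) = H.≈-trans (H.∙-cong (ind-act b v) (ind-act b w)) (H.≈-sym (·-distribˡ b _ _))

    ind-gen : ∀ {n} (t : Term A S n) → ind (gen t) ≡ tr (FS.termDegree t) (FS.termCoeff t · x (FS.termGen t))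
    ind-gen (term a s p) = refl

    ind-fold : ∀ {p} {P : Set p} {n} (h : P → Free A S n) (X : FAb P) →
               ind (FS.H.fold h X) ≡ H.fold (ind ∘ h) X
    ind-fold h (gen π) = refl
    ind-fold h zero = refl
    ind-fold h (neg X) = cong ⊖_ (ind-fold h X)
    ind-fold h (add X Y) = cong₂ _⊕_ (ind-fold h X) (ind-fold h Y)

    ind-negIf : ∀ {n} b (w : Free A S n) → ind (FS.negIf b w) ≡ negIf b (ind w)
    ind-negIf true w = refl
    ind-negIf false w = refl

    ind-tr : ∀ {n n'} (r : n ≡ n') (w : Free A S n) → ind (subst (Free A S) r w) ≡ tr r (ind w)
    ind-tr refl w = refl

    inducedHom : Hom A (FreeModule.freeModule S) N
    inducedHom = record
      { ⟦_⟧ = ind ; ⟦⟧-cong = ind-cong ; ⟦⟧-additive = λ _ _ → H.≈-refl ; ⟦⟧-linear = ind-act }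

  module HomProperties {N N' : GradedModule A} (f : Hom A N N') where
    private
      module N = ModuleProperties N
      module N' = ModuleProperties N'
    open Hom f

    ⟦⟧-ε : ∀ {d} → ⟦ GradedModule.ε N {d} ⟧ N'.H.≈ GradedModule.ε N'
    ⟦⟧-ε = N'.H.idempotent⇒ε
      (N'.H.≈-trans (⟦⟧-cong (N.H.≈-sym (N.H.identityˡ _))) (⟦⟧-additive _ _))

    ⟦⟧-⊖ : ∀ {d} (y : GradedModule.Carrier N d) →
           ⟦ GradedModule.⊖_ N y ⟧ N'.H.≈ GradedModule.⊖_ N' ⟦ y ⟧
    ⟦⟧-⊖ y = N'.H.inverseʳ-unique _ _
      (N'.H.≈-trans (N'.H.≈-sym (⟦⟧-additive y _)) (N'.H.≈-trans (⟦⟧-cong (N.H.inverseʳ y)) ⟦⟧-ε))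

  module Kernel {N N'' : GradedModule A} (h : Hom A N N'') where
    private
      module N = GradedModule N
      module N'' = GradedModule N''
      module NP = ModuleProperties N
      module NP'' = ModuleProperties N''
    open Hom h
    open HomProperties h

    KernelCarrier : ℤ → Set ℓ
    KernelCarrier d = Σ (N.Carrier d) λ y → ⟦ y ⟧ N''.≈ N''.ε

    kernel : GradedModule A
    kernel = record
      { grp = record
        { Carrier = KernelCarrier
        ; _≈_ = λ y y' → proj₁ y N.≈ proj₁ y'
        ; _⊕_ = λ { (y , hy≈ε) (y' , hy'≈ε) → y N.⊕ y' ,
            NP''.H.≈-trans (⟦⟧-additive y y')
              (NP''.H.≈-trans (NP''.H.∙-cong hy≈ε hy'≈ε) (NP''.H.identityˡ _)) }
        ; ε = N.ε , ⟦⟧-ε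
        ; ⊖_ = λ { (y , hy≈ε) → N.⊖ y ,
            NP''.H.≈-trans (⟦⟧-⊖ y) (NP''.H.≈-trans (NP''.H.⁻¹-cong hy≈ε) NP''.H.ε⁻¹≈ε) }
        ; isAbelianGroup = λ d → record
          { isGroup = record
            { isMonoid = record
              { isSemigroup = record
                { isMagma = record
                  { isEquivalence = record { refl = NP.H.≈-refl ; sym = NP.H.≈-sym ; trans = NP.H.≈-trans }
                  ; ∙-cong = NP.H.∙-cong }
                ; assoc = λ y y' y'' → NP.H.assoc (proj₁ y) (proj₁ y') (proj₁ y'') }
              ; identity = (λ y → NP.H.identityˡ (proj₁ y)) , (λ y → NP.H.identityʳ (proj₁ y)) }
            ; inverse = (λ y → NP.H.inverseˡ (proj₁ y)) , (λ y → NP.H.inverseʳ (proj₁ y))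
            ; ⁻¹-cong = NP.H.⁻¹-cong }
          ; comm = λ y y' → NP.H.comm (proj₁ y) (proj₁ y') } }
      ; _·_ = λ { a (y , hy≈ε) → a N.· y ,
          NP''.H.≈-trans (⟦⟧-linear a y)
            (NP''.H.≈-trans (N''.·-cong AP.H.≈-refl hy≈ε) (NP''.·-zeroʳ a)) }
      ; ·-cong = N.·-cong
      ; ·-distribˡ = λ a y y' → N.·-distribˡ a (proj₁ y) (proj₁ y')
      ; ·-distribʳ = λ a a' y → N.·-distribʳ a a' (proj₁ y)
      ; ·-assoc = λ {d} {e} {f} a b y →
          NP.H.≈-trans (NP.H.≈-reflexive (tr-proj₁ (ℤP.+-assoc d e f) _)) (N.·-assoc a b (proj₁ y))
      ; ·-identity = λ {d} y →
          NP.H.≈-trans (NP.H.≈-reflexive (tr-proj₁ (ℤP.+-identityˡ d) _)) (N.·-identity (proj₁ y)) }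
      where
      tr-proj₁ : ∀ {d e} (r : d ≡ e) (y : KernelCarrier d) →
                 proj₁ (subst KernelCarrier r y) ≡ N.tr r (proj₁ y)
      tr-proj₁ refl y = refl

    inclusion : Hom A kernel N
    inclusion = record
      { ⟦_⟧ = proj₁ ; ⟦⟧-cong = λ y≈y' → y≈y'
      ; ⟦⟧-additive = λ _ _ → NP.H.≈-refl ; ⟦⟧-linear = λ _ _ → NP.H.≈-refl }

    kernel-exact : IsExact A {KernelCarrier} N._≈_ N''._≈_ N''.ε proj₁ ⟦_⟧
    kernel-exact = (λ n → proj₂) , (λ n y hy≈ε → (y , hy≈ε) , NP.H.≈-refl)

  module TensorProperties (M N : GradedModule A) where
    private
      module M = GradedModule M
      module MP = ModuleProperties M
      module NP = ModuleProperties N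

    infix 4 _≈T_
    _≈T_ : ∀ {n} → Rel (Tensor A M N n) ℓ
    _≈T_ = _≈⊗_ A {M} {N}

    module TG {n : ℤ} = AbelianGroupProperties (closureAbelianGroup (TensorBase A M N {n}))

    pure-congˡ≋ : ∀ {n d d' e} {m : M.Carrier d} {m' : M.Carrier d'} (x : GradedModule.Carrier N e)
                  (p : d +ℤ e ≡ n) (p' : d' +ℤ e ≡ n) →
                  m MP.≋ m' → gen (pure p m x) ≈T gen (pure p' m' x)
    pure-congˡ≋ x refl refl (refl , m≈m') = base (⊗-congˡ refl x m≈m')

    pure-congʳ≋ : ∀ {n d e e'} (m : M.Carrier d) {x : GradedModule.Carrier N e} {x' : GradedModule.Carrier N e'}
                  (p : d +ℤ e ≡ n) (p' : d +ℤ e' ≡ n) →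
                  x NP.≋ x' → gen (pure p m x) ≈T gen (pure p' m x')
    pure-congʳ≋ m refl refl (refl , x≈x') = base (⊗-congʳ refl m x≈x')

    pure-εˡ : ∀ {n d e} (x : GradedModule.Carrier N e) (p : d +ℤ e ≡ n) →
              gen (pure p (M.ε {d}) x) ≈T zero
    pure-εˡ x p = TG.idempotent⇒ε
      (c-trans (base (⊗-congˡ p x (MP.H.≈-sym (MP.H.identityˡ M.ε)))) (base (⊗-addˡ p M.ε M.ε x)))

    pure-sumˡ : ∀ {n d e k} (f : Vector (M.Carrier d) k) (x : GradedModule.Carrier N e) (p : d +ℤ e ≡ n) →
                TG.sum (λ i → gen (pure p (f i) x)) ≈T gen (pure p (MP.H.sum f) x)
    pure-sumˡ {k = zero} f x p = c-sym (pure-εˡ x p)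
    pure-sumˡ {k = suc k} f x p =
      c-trans (add-cong c-refl (pure-sumˡ (f ∘ fsuc) x p)) (c-sym (base (⊗-addˡ p _ _ x)))

  -- m ⊗ ν ↦ m · φ ν for the right action m · a = (-1)^{|a| |m|} a · m; this Koszul sign is
  -- what makes the map respect the balance relation of M ⊗ N.
  module Contraction (M N : GradedModule A) {d : ℤ} (φ : Hom A N (shift regular d)) where
    private
      module M = GradedModule M
      module N = GradedModule N
      module MP = ModuleProperties M
      module φ = Hom φ
    open TensorProperties M N using (_≈T_)

    contractPure : ∀ {n} → Pure A M N n → M.Carrier (n +ℤ d)
    contractPure (pure {s} {t} p m ν) =
      M.tr (+-degree-shift s t d p) (MP.negIf (isOdd ((t +ℤ d) *ℤ s)) (φ.⟦ ν ⟧ M.· m))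

    contract : ∀ {n} → Tensor A M N n → M.Carrier (n +ℤ d)
    contract = MP.H.fold contractPure

    contract-signFAb : ∀ {n} k (X : Tensor A M N n) → contract (signFAb k X) M.≈ MP.negIf (isOdd k) (contract X)
    contract-signFAb k X with isOdd k
    ... | true = MP.H.≈-refl
    ... | false = MP.H.≈-refl

    contract-balance : ∀ {n k s t} (a : A.Carrier k) (m : M.Carrier s) (ν : N.Carrier t)
                       (p : (k +ℤ s) +ℤ t ≡ n) (q : s +ℤ (k +ℤ t) ≡ n) →
                       contractPure (pure p (a M.· m) ν) M.≈
                       MP.negIf (isOdd (k *ℤ s)) (contractPure (pure q m (a N.· ν)))
    contract-balance {k = k} {s} {t} a m ν p q = MP.≋⇒≈ (begin
        contractPure (pure p (a M.· m) ν)
      ≋⟨ MP.tr-≋ _ _ ⟩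
        MP.negIf b₁ (φ.⟦ ν ⟧ M.· (a M.· m))
      ≋⟨ MP.negIf-cong≋ b₁ (MP.·-assoc≋ φ.⟦ ν ⟧ a m) ⟨
        MP.negIf b₁ ((φ.⟦ ν ⟧ A.* a) M.· m)
      ≋⟨ MP.negIf-cong≋ b₁ (MP.·-cong≋ (*-comm≋ φ.⟦ ν ⟧ a) MP.≋-refl) ⟩
        MP.negIf b₁ (RP.negIf b₂ (a A.* φ.⟦ ν ⟧) M.· m)
      ≈⟨ MP.negIf-cong b₁ (MP.·-negIfˡ b₂ _ m) ⟩
        MP.negIf b₁ (MP.negIf b₂ Y)
      ≈⟨ MP.H.≈-sym (MP.negIf-xor b₁ b₂ Y) ⟩
        MP.negIf (b₁ xor b₂) Y
      ≡⟨ cong (λ b → MP.negIf b Y) (balance-parity k s t d) ⟩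
        MP.negIf (b₃ xor b₄) Y
      ≈⟨ MP.negIf-xor b₃ b₄ Y ⟩
        MP.negIf b₃ (MP.negIf b₄ Y)
      ≋⟨ MP.negIf-cong≋ b₃ (MP.negIf-cong≋ b₄ (MP.·-cong≋ φ-linear≋ MP.≋-refl)) ⟨
        MP.negIf b₃ (MP.negIf b₄ (φ.⟦ a N.· ν ⟧ M.· m))
      ≋⟨ MP.negIf-cong≋ b₃ (MP.tr-≋ _ _) ⟨
        MP.negIf b₃ (contractPure (pure q m (a N.· ν)))
      ∎)
      where
      open MP.≋-Reasoning
      Y = (a A.* φ.⟦ ν ⟧) M.· m
      b₁ = isOdd ((t +ℤ d) *ℤ (k +ℤ s))
      b₂ = isOdd ((t +ℤ d) *ℤ k)
      b₃ = isOdd (k *ℤ s)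
      b₄ = isOdd (((k +ℤ t) +ℤ d) *ℤ s)
      φ-linear≋ : φ.⟦ a N.· ν ⟧ RP.≋ a A.* φ.⟦ ν ⟧
      φ-linear≋ = RP.≋-trans (RP.≈⇒≋ (φ.⟦⟧-linear a ν)) (RP.tr-≋ _ _)

    contract-cong : ∀ {n} {X Y : Tensor A M N n} → X ≈T Y → contract X M.≈ contract Y
    contract-cong (base (⊗-congˡ {s} {t} p ν m≈m')) =
      MP.tr-cong (+-degree-shift s t d p) (MP.negIf-cong (isOdd ((t +ℤ d) *ℤ s))
        (M.·-cong AP.H.≈-refl m≈m'))
    contract-cong (base (⊗-congʳ {s} {t} p m ν≈ν')) =
      MP.tr-cong (+-degree-shift s t d p) (MP.negIf-cong (isOdd ((t +ℤ d) *ℤ s))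
        (M.·-cong (φ.⟦⟧-cong ν≈ν') MP.H.≈-refl))
    contract-cong (base (⊗-addˡ {s} {t} p m m' ν)) =
      MP.H.≈-trans (MP.tr-cong deg (MP.H.≈-trans (MP.negIf-cong b (M.·-distribˡ φ.⟦ ν ⟧ m m'))
                                                  (MP.negIf-⊕ b _ _)))
                   (MP.H.≈-reflexive (MP.tr-⊕ deg _ _))
      where
      deg = +-degree-shift s t d p
      b = isOdd ((t +ℤ d) *ℤ s)
    contract-cong (base (⊗-addʳ {s} {t} p m ν ν')) =
      MP.H.≈-trans (MP.tr-cong deg (MP.H.≈-trans (MP.negIf-cong b φ-additive) (MP.negIf-⊕ b _ _)))
                   (MP.H.≈-reflexive (MP.tr-⊕ deg _ _))
      where
      deg = +-degree-shift s t d p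
      b = isOdd ((t +ℤ d) *ℤ s)
      φ-additive = MP.H.≈-trans (M.·-cong (φ.⟦⟧-additive ν ν') MP.H.≈-refl)
                                (M.·-distribʳ φ.⟦ ν ⟧ φ.⟦ ν' ⟧ m)
    contract-cong (base (⊗-balance {k} {s} a m ν p q)) =
      MP.H.≈-trans (contract-balance a m ν p q) (MP.H.≈-sym (contract-signFAb (k *ℤ s) _))
    contract-cong c-refl = MP.H.≈-refl
    contract-cong (c-sym X≈Y) = MP.H.≈-sym (contract-cong X≈Y)
    contract-cong (c-trans X≈Y Y≈Z) = MP.H.≈-trans (contract-cong X≈Y) (contract-cong Y≈Z)
    contract-cong (add-cong X≈X' Y≈Y') = MP.H.∙-cong (contract-cong X≈X') (contract-cong Y≈Y')
    contract-cong (neg-cong X≈Y) = MP.H.⁻¹-cong (contract-cong X≈Y)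
    contract-cong (add-assoc X Y Z) = MP.H.assoc _ _ _
    contract-cong (add-comm X Y) = MP.H.comm _ _
    contract-cong (add-idˡ X) = MP.H.identityˡ _
    contract-cong (add-invˡ X) = MP.H.inverseˡ _

  -- Relations of a flat evenly generated module

  module FlatEvenlyGenerated (M : GradedModule A) (flat : Flat A M) {S : ℤ → Set ℓ}
      (x : ∀ {d} → S d → GradedModule.Carrier M d) (S-even : Even A S) (x-generates : Generates A M x) where
    private
      module M = GradedModule M
      module MP = ModuleProperties M
      module FS = FreeModule S
    open Induced M x using (ind; ind-cong; ind-act; ind-tr; ind-gen; ind-fold; ind-negIf)

    liftM : ∀ {d} → M.Carrier d → Free A S d
    liftM {d} m = proj₁ (x-generates d m)

    ind-liftM : ∀ {d} (m : M.Carrier d) → ind (liftM m) M.≈ m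
    ind-liftM {d} m = proj₂ (x-generates d m)

    EvenRelation : ℤ → Set ℓ
    EvenRelation d = (isOdd d ≡ false) × Σ (Free A S d) λ w → ind w M.≈ M.ε

    relation : ∀ {d} → EvenRelation d → Free A S d
    relation = proj₁ ∘ proj₂

    EvenRelation-even : Even A EvenRelation
    EvenRelation-even d d-odd (d-even , _) with trans (sym d-odd) d-even
    ... | ()

    module OddDegreeRelation (n : ℤ) (n-odd : isOdd n ≡ true) {k : ℕ} (ts : Vector (Term A S n) k)
        (∑ts-ker : ind (FS.H.sum (gen ∘ ts)) M.≈ M.ε) where
      e d : Fin k → ℤ
      e = FS.termCoeffDegree ∘ ts
      d = FS.termGenDegree ∘ ts

      a : (i : Fin k) → A.Carrier (e i)
      a = FS.termCoeff ∘ ts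

      s : (i : Fin k) → S (d i)
      s = FS.termGen ∘ ts

      e+d≡n : ∀ i → e i +ℤ d i ≡ n
      e+d≡n = FS.termDegree ∘ ts

      d-even : ∀ i → isOdd (d i) ≡ false
      d-even i with isOdd (d i) in d-odd
      ... | true = ⊥-elim (S-even (d i) d-odd (s i))
      ... | false = refl

      e-odd : ∀ i → isOdd (e i) ≡ true
      e-odd i = trans (sym (isOdd-+even (e i) (d i) (d-even i))) (trans (cong isOdd (e+d≡n i)) n-odd)

      U V : ℤ → Set ℓ
      U t = Lift ℓ (Σ (Fin k) λ i → - d i ≡ t)
      V t = Lift ℓ (- n ≡ t)

      u : (i : Fin k) → U (- d i)
      u i = lift (i , refl)

      v : V (- n)
      v = lift refl

      module FU = FreeModule U
      module FV = FreeModule V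
      module TU = TensorProperties M FU.freeModule
      module TV = TensorProperties M FV.freeModule

      basisU : (i : Fin k) → Free A U (- d i)
      basisU i = gen (term A.1# (u i) (ℤP.+-identityˡ (- d i)))

      basisV : Free A V (- n)
      basisV = gen (term A.1# v (ℤP.+-identityˡ (- n)))

      e-n≡-d : ∀ i → e i +ℤ - n ≡ - d i
      e-n≡-d i = trans (cong (λ m → e i +ℤ - m) (sym (e+d≡n i)))
                       (solve 2 (λ e d → e :+ :- (e :+ d) := :- d) refl (e i) (d i))

      g-on-U : ∀ {t} → U t → Free A V t
      g-on-U (lift (i , refl)) = gen (term (a i) v (e-n≡-d i))

      module G = Induced FV.freeModule g-on-U

      g : Hom A FU.freeModule FV.freeModule
      g = G.inducedHom

      Φ-summand : Fin k → Tensor A M FU.freeModule 0ℤ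
      Φ-summand i = gen (pure (ℤP.+-inverseʳ (d i)) (x (s i)) (basisU i))

      Φ : Tensor A M FU.freeModule 0ℤ
      Φ = TU.TG.sum Φ-summand

      g-basisU : ∀ i → G.ind (basisU i) FV.≋ actFree A (a i) basisV
      g-basisU i = FV.≋-trans (FV.tr-≋ _ _)
        (FV.gen-≋ v _ _ (RP.≋-trans (RP.·-identity≋ (a i)) (RP.≋-sym (*-identityʳ≋ (a i)))))

      g-summand : ∀ i → gen (pure (ℤP.+-inverseʳ (d i)) (x (s i)) (G.ind (basisU i)))
                    TV.≈T gen (pure (ℤP.+-inverseʳ n) (ind (gen (ts i))) basisV)
      g-summand i = begin
          gen (pure (ℤP.+-inverseʳ (d i)) (x (s i)) (G.ind (basisU i)))
        ≈⟨ TV.pure-congʳ≋ (x (s i)) _ Q (g-basisU i) ⟩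
          gen (pure Q (x (s i)) (actFree A (a i) basisV))
        ≡⟨ signFAb-even (e i *ℤ d i) _ (isOdd-*even (e i) (d i) (d-even i)) ⟨
          signFAb (e i *ℤ d i) (gen (pure Q (x (s i)) (actFree A (a i) basisV)))
        ≈⟨ base (⊗-balance (a i) (x (s i)) basisV P Q) ⟨
          gen (pure P (a i M.· x (s i)) basisV)
        ≈⟨ TV.pure-congˡ≋ basisV P _ (MP.≋-sym ind-tsᵢ) ⟩
          gen (pure (ℤP.+-inverseʳ n) (ind (gen (ts i))) basisV)
        ∎
        where
        P : (e i +ℤ d i) +ℤ - n ≡ 0ℤ
        P = trans (cong (_+ℤ - n) (e+d≡n i)) (ℤP.+-inverseʳ n)
        Q : d i +ℤ (e i +ℤ - n) ≡ 0ℤ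
        Q = trans (cong (d i +ℤ_) (e-n≡-d i)) (ℤP.+-inverseʳ (d i))
        ind-tsᵢ : ind (gen (ts i)) MP.≋ a i M.· x (s i)
        ind-tsᵢ = MP.≋-trans (MP.≈⇒≋ (MP.H.≈-reflexive (ind-gen (ts i)))) (MP.tr-≋ _ _)
        open TV.TG.≈-Reasoning

      Φ↦0 : tensorMap A M g Φ TV.≈T zero
      Φ↦0 = begin
          tensorMap A M g Φ
        ≡⟨ mapFAb-sum _ Φ-summand ⟩
          TV.TG.sum (tensorMap A M g ∘ Φ-summand)
        ≈⟨ TV.TG.sum-cong-≋ g-summand ⟩
          TV.TG.sum (λ i → gen (pure (ℤP.+-inverseʳ n) (ind (gen (ts i))) basisV))
        ≈⟨ TV.pure-sumˡ (ind ∘ gen ∘ ts) basisV (ℤP.+-inverseʳ n) ⟩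
          gen (pure (ℤP.+-inverseʳ n) (MP.H.sum (ind ∘ gen ∘ ts)) basisV)
        ≈⟨ base (⊗-congˡ _ basisV (MP.H.≈-trans (MP.H.≈-reflexive (sym (MP.H.fold-sum _ (gen ∘ ts))))
                                              ∑ts-ker)) ⟩
          gen (pure (ℤP.+-inverseʳ n) M.ε basisV)
        ≈⟨ TV.pure-εˡ basisV _ ⟩
          zero
        ∎
        where open TV.TG.≈-Reasoning

      δ : (i : Fin k) → ∀ {t} → U t → A.Carrier (t +ℤ d i)
      δ i (lift (j , refl)) with j Fin.≟ i
      ... | yes refl = A.tr (sym (ℤP.+-inverseˡ (d i))) A.1#
      ... | no _ = A.ε

      δ-diagonal : ∀ i → δ i (u i) RP.≋ A.1#
      δ-diagonal i with i Fin.≟ i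
      ... | yes refl = RP.tr-≋ _ A.1#
      ... | no i≢i = ⊥-elim (i≢i refl)

      δ-offDiagonal : ∀ i j → j ≢ i → δ i (u j) A.≈ A.ε
      δ-offDiagonal i j j≢i with j Fin.≟ i
      ... | yes j≡i = ⊥-elim (j≢i j≡i)
      ... | no _ = RP.H.≈-refl

      coordinate : (i : Fin k) → Hom A FU.freeModule (shift regular (d i))
      coordinate i = Induced.inducedHom (shift regular (d i)) (δ i)

      coordinate-gen : ∀ i j {t e'} (c : A.Carrier e') (q : e' +ℤ - d j ≡ t) →
                       Hom.⟦ coordinate i ⟧ (gen (term c (u j) q)) RP.≋ c A.* δ i (u j)
      coordinate-gen i j c q = RP.≋-trans (RP.subst-≋ (_+ℤ d i) q _) (RP.tr-≋ _ _)

      coordinate-basis : ∀ i j → Hom.⟦ coordinate i ⟧ (basisU j) RP.≋ δ i (u j)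
      coordinate-basis i j =
        RP.≋-trans (coordinate-gen i j A.1# (ℤP.+-identityˡ (- d j))) (RP.·-identity≋ (δ i (u j)))

      module π (i : Fin k) = Contraction M FU.freeModule (coordinate i)

      π-Φ : ∀ i → π.contract i Φ MP.≋ x (s i)
      π-Φ i = begin
          π.contract i Φ
        ≡⟨ MP.H.fold-sum (π.contractPure i) Φ-summand ⟩
          MP.H.sum (π.contract i ∘ Φ-summand)
        ≈⟨ MP.H.sum-δ i off-diagonal ⟩
          π.contract i (Φ-summand i)
        ≋⟨ MP.tr-≋ _ _ ⟩
          MP.negIf (isOdd ((- d i +ℤ d i) *ℤ d i)) (cᵢ M.· x (s i))
        ≡⟨ cong (λ b → MP.negIf b (cᵢ M.· x (s i))) (isOdd-*even (- d i +ℤ d i) (d i) (d-even i)) ⟩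
          cᵢ M.· x (s i)
        ≋⟨ MP.·-cong≋ (RP.≋-trans (coordinate-basis i i) (δ-diagonal i)) MP.≋-refl ⟩
          A.1# M.· x (s i)
        ≋⟨ MP.·-identity≋ (x (s i)) ⟩
          x (s i)
        ∎
        where
        open MP.≋-Reasoning
        cᵢ = Hom.⟦ coordinate i ⟧ (basisU i)
        off-diagonal : ∀ j → j ≢ i → π.contract i (Φ-summand j) M.≈ M.ε
        off-diagonal j j≢i = MP.H.≈-trans (MP.tr-cong _ (MP.H.≈-trans (MP.negIf-cong b
            (MP.H.≈-trans (M.·-cong (RP.H.≈-trans (RP.≋⇒≈ (coordinate-basis i j)) (δ-offDiagonal i j j≢i))
                                    MP.H.≈-refl)
                          (MP.·-zeroˡ (x (s j)))))
            (MP.negIf-ε b)))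
          (MP.H.≈-reflexive (MP.tr-ε _))
          where b = isOdd ((- d j +ℤ d i) *ℤ d j)

      δV : ∀ {t} → V t → A.Carrier (t +ℤ n)
      δV (lift refl) = A.tr (sym (ℤP.+-inverseˡ n)) A.1#

      coordinateV : Hom A FV.freeModule (shift regular n)
      coordinateV = Induced.inducedHom (shift regular n) δV

      coordinateV-gen : ∀ {t e'} (c : A.Carrier e') (q : e' +ℤ - n ≡ t) →
                        Hom.⟦ coordinateV ⟧ (gen (term c v q)) RP.≋ c
      coordinateV-gen c q = RP.≋-trans (RP.subst-≋ (_+ℤ n) q _)
        (RP.≋-trans (RP.tr-≋ _ _)
        (RP.≋-trans (RP.·-cong≋ RP.≋-refl (RP.tr-≋ _ A.1#)) (*-identityʳ≋ c)))

      weight-degree : ∀ t i → (t +ℤ d i) +ℤ e i ≡ t +ℤ n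
      weight-degree t i = trans (solve 3 (λ t d e → (t :+ d) :+ e := t :+ (e :+ d)) refl t (d i) (e i))
                                (cong (t +ℤ_) (e+d≡n i))

      weighted : ∀ {t} → Free A U t → Fin k → A.Carrier (t +ℤ n)
      weighted {t} κ i = A.tr (weight-degree t i) (Hom.⟦ coordinate i ⟧ κ A.* a i)

      weighted-gen : ∀ i {j t e'} (c : A.Carrier e') (q : e' +ℤ - d j ≡ t) →
                     weighted (gen (term c (u j) q)) i RP.≋ (c A.* δ i (u j)) A.* a i
      weighted-gen i c q = RP.≋-trans (RP.tr-≋ _ _) (RP.·-cong≋ (coordinate-gen i _ c q) RP.≋-refl)

      coordinateV∘g : ∀ {t} (κ : Free A U t) → Hom.⟦ coordinateV ⟧ (G.ind κ) A.≈ RP.H.sum (weighted κ)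
      coordinateV∘g {t} (gen (term c (lift (j , refl)) q)) = RP.≋⇒≈ (begin
          Hom.⟦ coordinateV ⟧ (G.ind κ)
        ≡⟨ Induced.ind-tr (shift regular n) δV q _ ⟩
          subst (A.Carrier ∘ (_+ℤ n)) q (Hom.⟦ coordinateV ⟧ (actFree A c (g-on-U (u j))))
        ≋⟨ RP.subst-≋ (_+ℤ n) q _ ⟩
          Hom.⟦ coordinateV ⟧ (actFree A c (g-on-U (u j)))
        ≋⟨ RP.≋-trans (RP.≈⇒≋ (Hom.⟦⟧-linear coordinateV c (g-on-U (u j)))) (RP.tr-≋ _ _) ⟩
          c A.* Hom.⟦ coordinateV ⟧ (g-on-U (u j))
        ≋⟨ RP.·-cong≋ RP.≋-refl (coordinateV-gen (a j) (e-n≡-d j)) ⟩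
          c A.* a j
        ≋⟨ RP.·-cong≋ (RP.≋-trans (RP.·-cong≋ RP.≋-refl (δ-diagonal j)) (*-identityʳ≋ c))
                      RP.≋-refl ⟨
          (c A.* δ j (u j)) A.* a j
        ≋⟨ weighted-gen j c q ⟨
          weighted κ j
        ≈⟨ RP.H.sum-δ j off-diagonal ⟨
          RP.H.sum (weighted κ)
        ∎)
        where
        open RP.≋-Reasoning
        κ = gen (term c (u j) q)
        off-diagonal : ∀ i → i ≢ j → weighted κ i A.≈ A.ε
        off-diagonal i i≢j = RP.≋ε⇒≈ε (RP.≋-trans (weighted-gen i c q) (RP.≋-trans
          (RP.·-cong≋ (RP.≋-trans (RP.·-cong≋ RP.≋-refl (RP.≈⇒≋ (δ-offDiagonal i j (i≢j ∘ sym))))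
                                  (RP.≈⇒≋ (RP.·-zeroʳ c))) RP.≋-refl)
          (RP.≈⇒≋ (RP.·-zeroˡ (a i)))))
      coordinateV∘g {t} zero = RP.H.≈-sym (RP.H.sum-ε λ i →
        RP.H.≈-trans (RP.tr-cong (weight-degree t i) (RP.·-zeroˡ (a i))) (RP.H.≈-reflexive (RP.tr-ε _)))
      coordinateV∘g {t} (neg κ) = RP.H.≈-trans (RP.H.⁻¹-cong (coordinateV∘g κ))
        (RP.H.≈-trans (RP.H.≈-sym (RP.H.sum-⁻¹ (weighted κ))) (RP.H.sum-cong-≋ λ i →
          RP.H.≈-trans (RP.H.≈-reflexive (sym (RP.tr-⊖ (weight-degree t i) _)))
                       (RP.tr-cong (weight-degree t i) (RP.H.≈-sym (RP.·-negˡ _ (a i))))))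
      coordinateV∘g {t} (add κ κ') = RP.H.≈-trans (RP.H.∙-cong (coordinateV∘g κ) (coordinateV∘g κ'))
        (RP.H.≈-trans (RP.H.≈-sym (RP.H.∑-distrib-+ (weighted κ) (weighted κ'))) (RP.H.sum-cong-≋ λ i →
          RP.H.≈-trans (RP.H.≈-reflexive (sym (RP.tr-⊕ (weight-degree t i) _ _)))
                       (RP.tr-cong (weight-degree t i) (RP.H.≈-sym (A.*-distribʳ _ _ (a i))))))

      ∑weighted-ker : ∀ {t} (κ : Free A U t) → G.ind κ FV.≈F zero → RP.H.sum (weighted κ) A.≈ A.ε
      ∑weighted-ker κ gκ≈0 =
        RP.H.≈-trans (RP.H.≈-sym (coordinateV∘g κ)) (Hom.⟦⟧-cong coordinateV gκ≈0)

      module K = Kernel g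

      Φ-preimage : ∃ λ (Ψ : Tensor A M K.kernel 0ℤ) → tensorMap A M K.inclusion Ψ TU.≈T Φ
      Φ-preimage = proj₂ (flat K.kernel FU.freeModule FV.freeModule K.inclusion g K.kernel-exact) 0ℤ Φ Φ↦0

      Ψ : Tensor A M K.kernel 0ℤ
      Ψ = proj₁ Φ-preimage

      -- L i lifts the i-th coordinate of Ψ to A(S); since liftM is not additive, it is computed
      -- on the representative Ψ itself rather than on its class.
      L-pure : (i : Fin k) → Pure A M K.kernel 0ℤ → Free A S (0ℤ +ℤ d i)
      L-pure i (pure {s'} {t} r m κ) = subst (Free A S) (+-degree-shift s' t (d i) r)
        (FS.negIf (isOdd ((t +ℤ d i) *ℤ s')) (actFree A (Hom.⟦ coordinate i ⟧ (proj₁ κ)) (liftM m)))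

      L : (i : Fin k) → Free A S (0ℤ +ℤ d i)
      L i = FS.H.fold (L-pure i) Ψ

      ind-L-pure : ∀ i {s' t} (r : s' +ℤ t ≡ 0ℤ) (m : M.Carrier s') (κ : K.KernelCarrier t) →
                     ind (L-pure i (pure r m κ)) M.≈ π.contractPure i (pure r m (proj₁ κ))
      ind-L-pure i {s'} {t} r m κ =
        MP.H.≈-trans (MP.H.≈-reflexive (trans (ind-tr deg _) (cong (M.tr deg) (ind-negIf b _))))
        (MP.tr-cong deg (MP.negIf-cong b
          (MP.H.≈-trans (ind-act (Hom.⟦ coordinate i ⟧ (proj₁ κ)) (liftM m))
                        (M.·-cong RP.H.≈-refl (ind-liftM m)))))
        where
        b = isOdd ((t +ℤ d i) *ℤ s')
        deg = +-degree-shift s' t (d i) r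

      ind-L : ∀ i → ind (L i) MP.≋ x (s i)
      ind-L i = begin
          ind (L i)
        ≡⟨ ind-fold (L-pure i) Ψ ⟩
          MP.H.fold (ind ∘ L-pure i) Ψ
        ≈⟨ MP.H.≈-trans (MP.H.fold-cong (λ { (pure r m κ) → ind-L-pure i r m κ }) Ψ)
                        (MP.H.≈-reflexive (sym (MP.H.fold-mapFAb (π.contractPure i) _ Ψ))) ⟩
          π.contract i (tensorMap A M K.inclusion Ψ)
        ≈⟨ π.contract-cong i (proj₂ Φ-preimage) ⟩
          π.contract i Φ
        ≋⟨ π-Φ i ⟩
          x (s i)
        ∎
        where open MP.≋-Reasoning

      evenRelation : (i : Fin k) → EvenRelation (0ℤ +ℤ d i)
      evenRelation i = trans (cong isOdd (ℤP.+-identityˡ (d i))) (d-even i) ,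
                       add (gen (term A.1# (s i) refl)) (neg (L i)) ,
                       MP.H.≈-trans (MP.H.∙-cong MP.H.≈-refl (MP.H.⁻¹-cong ind-L≈1·x)) (MP.H.inverseʳ _)
        where
        ind-L≈1·x : ind (L i) M.≈ A.1# M.· x (s i)
        ind-L≈1·x = MP.≋⇒≈ (MP.≋-trans (ind-L i) (MP.≋-sym (MP.·-identity≋ (x (s i)))))

      relation-degree : ∀ i → e i +ℤ (0ℤ +ℤ d i) ≡ n
      relation-degree i = trans (cong (e i +ℤ_) (ℤP.+-identityˡ (d i))) (e+d≡n i)

      module FR = FreeModule EvenRelation

      combinationTerm : Fin k → Free A EvenRelation n
      combinationTerm i = gen (term (a i) (evenRelation i) (relation-degree i))

      combination : Free A EvenRelation n
      combination = FR.H.sum combinationTerm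

      a·L : Fin k → Free A S n
      a·L i = subst (Free A S) (relation-degree i) (actFree A (a i) (L i))

      a·L-pure : Fin k → Pure A M K.kernel 0ℤ → Free A S n
      a·L-pure i = subst (Free A S) (relation-degree i) ∘ actFree A (a i) ∘ L-pure i

      combination-summand : ∀ i →
        inducedFree A relation (combinationTerm i) FS.≈F add (gen (ts i)) (neg (a·L i))
      combination-summand i =
        c-trans (FS.≡⇒≈F (trans (FS.tr-⊕ (relation-degree i) _ _)
                                (cong (add _) (FS.tr-⊖ (relation-degree i) _))))
        (add-cong (c-trans (FS.≋⇒≈ (FS.≋-trans (FS.tr-≋ _ _)
                                              (FS.gen-≋ (s i) _ (e+d≡n i) (*-identityʳ≋ (a i)))))
                           (FS.≡⇒≈F (cong gen (FS.term-η (ts i)))))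
                  c-refl)

      signs-cancel : ∀ i s' t → s' +ℤ t ≡ 0ℤ →
                     isOdd ((t +ℤ d i) *ℤ s') xor isOdd (e i *ℤ (t +ℤ d i)) ≡ false
      signs-cancel i s' t r = trans (cong₂ _xor_ contraction-sign commutation-sign) (xor-same (isOdd t))
        where
        t+d≡t : isOdd (t +ℤ d i) ≡ isOdd t
        t+d≡t = isOdd-+even t (d i) (d-even i)
        contraction-sign : isOdd ((t +ℤ d i) *ℤ s') ≡ isOdd t
        contraction-sign = trans (isOdd-* (t +ℤ d i) s')
                                 (trans (cong₂ _∧_ t+d≡t (isOdd-+≡0 s' t r)) (∧-idem (isOdd t)))
        commutation-sign : isOdd (e i *ℤ (t +ℤ d i)) ≡ isOdd t
        commutation-sign = trans (isOdd-* (e i) (t +ℤ d i)) (cong₂ _∧_ (e-odd i) t+d≡t)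

      a·L-pure≋ : ∀ i {s' t} (r : s' +ℤ t ≡ 0ℤ) (m : M.Carrier s') (κ : K.KernelCarrier t) →
                    a·L-pure i (pure r m κ) FS.≋ actFree A (weighted (proj₁ κ) i) (liftM m)
      a·L-pure≋ i {s'} {t} r m κ = begin
          subst (Free A S) (relation-degree i) (a i · L-pure i (pure r m κ))
        ≋⟨ FS.tr-≋ _ _ ⟩
          a i · subst (Free A S) deg (FS.negIf b₁ (c · lm))
        ≋⟨ FS.·-tr≋ (a i) deg _ ⟩
          a i · FS.negIf b₁ (c · lm)
        ≈⟨ FS.·-negIfʳ b₁ (a i) (c · lm) ⟩
          FS.negIf b₁ (a i · (c · lm))
        ≋⟨ FS.negIf-cong≋ b₁ (FS.·-assoc≋ (a i) c lm) ⟨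
          FS.negIf b₁ ((a i A.* c) · lm)
        ≋⟨ FS.negIf-cong≋ b₁ (FS.·-cong≋ (*-comm≋ (a i) c) FS.≋-refl) ⟩
          FS.negIf b₁ (RP.negIf b₂ (c A.* a i) · lm)
        ≈⟨ FS.negIf-cong b₁ (FS.·-negIfˡ b₂ (c A.* a i) lm) ⟩
          FS.negIf b₁ (FS.negIf b₂ ((c A.* a i) · lm))
        ≈⟨ FS.H.≈-sym (FS.negIf-xor b₁ b₂ _) ⟩
          FS.negIf (b₁ xor b₂) ((c A.* a i) · lm)
        ≡⟨ cong (λ b → FS.negIf b ((c A.* a i) · lm)) (signs-cancel i s' t r) ⟩
          (c A.* a i) · lm
        ≋⟨ FS.·-cong≋ (RP.tr-≋ _ _) FS.≋-refl ⟨
          weighted (proj₁ κ) i · lm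
        ∎
        where
        open FS.≋-Reasoning
        _·_ : ∀ {k n} → A.Carrier k → Free A S n → Free A S (k +ℤ n)
        _·_ = actFree A
        c = Hom.⟦ coordinate i ⟧ (proj₁ κ)
        lm = liftM m
        deg = +-degree-shift s' t (d i) r
        b₁ = isOdd ((t +ℤ d i) *ℤ s')
        b₂ = isOdd (e i *ℤ (t +ℤ d i))

      ∑a·L-pure : ∀ {s' t} (r : s' +ℤ t ≡ 0ℤ) (m : M.Carrier s') (κ : K.KernelCarrier t) →
                 FS.H.sum (λ i → a·L-pure i (pure r m κ)) FS.≈F zero
      ∑a·L-pure {s'} {t} r m κ = begin
          FS.H.sum (λ i → a·L-pure i (pure r m κ))
        ≈⟨ FS.H.sum-cong-≋ summand≈ ⟩
          FS.H.sum (λ i → subst (Free A S) R (actFree A (w i) lm))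
        ≡⟨ FS.tr-sum R (λ i → actFree A (w i) lm) ⟨
          subst (Free A S) R (FS.H.sum (λ i → actFree A (w i) lm))
        ≈⟨ FS.tr-cong R (FS.·-sumˡ w lm) ⟨
          subst (Free A S) R (actFree A (RP.H.sum w) lm)
        ≈⟨ FS.tr-cong R (FS.act-congˡ (∑weighted-ker (proj₁ κ) (proj₂ κ)) lm) ⟩
          subst (Free A S) R (actFree A (A.ε {t +ℤ n}) lm)
        ≈⟨ FS.tr-cong R (FS.·-zeroˡ lm) ⟩
          subst (Free A S) R zero
        ≡⟨ FS.tr-ε R ⟩
          zero
        ∎
        where
        open FS.H.≈-Reasoning
        R = trans (+-degree-shift s' t n r) (ℤP.+-identityˡ n)
        w = weighted (proj₁ κ)
        lm = liftM m
        summand≈ : ∀ i → a·L-pure i (pure r m κ) FS.≈F subst (Free A S) R (actFree A (w i) lm)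
        summand≈ i = FS.≋⇒≈ (FS.≋-trans (a·L-pure≋ i r m κ) (FS.≋-sym (FS.tr-≋ R _)))

      ∑a·L≈0 : FS.H.sum a·L FS.≈F zero
      ∑a·L≈0 = begin
          FS.H.sum a·L
        ≡⟨ FS.H.sum-cong-≗ (λ i →
             trans (cong (subst (Free A S) (relation-degree i)) (FS.act-fold (a i) (L-pure i) Ψ))
                   (FS.tr-fold (relation-degree i) _ Ψ)) ⟩
          FS.H.sum (λ i → FS.H.fold (a·L-pure i) Ψ)
        ≈⟨ FS.H.sum-fold a·L-pure Ψ ⟩
          FS.H.fold (λ P → FS.H.sum (λ i → a·L-pure i P)) Ψ
        ≈⟨ FS.H.fold-ε (λ { (pure r m κ) → ∑a·L-pure r m κ }) Ψ ⟩
          zero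
        ∎
        where open FS.H.≈-Reasoning

      combination-spans : inducedFree A relation combination FS.≈F FS.H.sum (gen ∘ ts)
      combination-spans = begin
          inducedFree A relation combination
        ≡⟨ FS.H.fold-sum _ combinationTerm ⟩
          FS.H.sum (inducedFree A relation ∘ combinationTerm)
        ≈⟨ FS.H.sum-cong-≋ combination-summand ⟩
          FS.H.sum (λ i → add (gen (ts i)) (neg (a·L i)))
        ≈⟨ FS.H.∑-distrib-+ (gen ∘ ts) (neg ∘ a·L) ⟩
          add (FS.H.sum (gen ∘ ts)) (FS.H.sum (neg ∘ a·L))
        ≈⟨ add-cong c-refl (FS.H.sum-⁻¹ a·L) ⟩
          add (FS.H.sum (gen ∘ ts)) (neg (FS.H.sum a·L))
        ≈⟨ add-cong c-refl (c-trans (neg-cong ∑a·L≈0) FS.H.ε⁻¹≈ε) ⟩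
          add (FS.H.sum (gen ∘ ts)) zero
        ≈⟨ FS.H.identityʳ _ ⟩
          FS.H.sum (gen ∘ ts)
        ∎
        where open FS.H.≈-Reasoning

    evenRelations-generateKernel : ∀ n (z : Free A S n) → ind z M.≈ M.ε →
                         ∃ λ (w : Free A EvenRelation n) → inducedFree A relation w FS.≈F z
    evenRelations-generateKernel n z z-ker with isOdd n in n-parity
    ... | false = gen (term A.1# (n-parity , z , z-ker) (ℤP.+-identityˡ n)) ,
                  FS.≋⇒≈ (FS.≋-trans (FS.tr-≋ _ _) (FS.act-identity≋ z))
    ... | true with FS.asSumOfTerms z
    ... | k , ts , z≈∑ts = O.combination , c-trans O.combination-spans (c-sym z≈∑ts)
      where module O = OddDegreeRelation n n-parity ts (MP.H.≈-trans (ind-cong (c-sym z≈∑ts)) z-ker)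

    evenlyPresented : EvenlyPresented A M
    evenlyPresented = S , x , S-even , x-generates ,
                      EvenRelation , relation , EvenRelation-even , (λ d r → proj₂ (proj₂ r)) ,
                      evenRelations-generateKernel

proposition3p10 : ∀ {ℓ : Level} (A : DiracRing ℓ) (M : GradedModule A) →
                    Flat A M → EvenlyGenerated A M → EvenlyPresented A M
proposition3p10 A M flat (S , x , S-even , x-generates) =
  GradedModules.FlatEvenlyGenerated.evenlyPresented A M flat x S-even x-generates
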